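{- Let $p$ be a prime and $F\colon\mathbb F_p^n\to\mathbb F_p^n$ a $t$-plateaued function for some $t>0$. Then its differential uniformity $\delta$ satisfies $\delta\ge p^t$. Moreover, $\delta=p^t$ if and only if for every nonzero $a$ and every $b$ the equation $F(x+a)-F(x)=b$ has either $0$ or $p^t$ solutions $x\in\mathbb F_p^n$.
   Context: Standard scalar product, $\zeta_p=e^{2\pi i/p}$. For $f\colon\mathbb F_p^n\to\mathbb F_p$, $W_f(a)=\sum_x\zeta_p^{f(x)-\langle a,x\rangle}$; $f$ is $t$-plateaued if $|W_f(a)|\in\{0,p^{(n+t)/2}\}$ for all $a$. $F$ is $t$-plateaued if all components $F_b(x)=\langle b,F(x)\rangle$, $b\ne0$, are $t$-plateaued. The differential uniformity $\delta$ of $F$ is the maximum over $a\ne0$ and all $b$ of the number of solutions $x$ of $F(x+a)-F(x)=b$. -}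

module Defs where

open import Data.Nat using (ℕ; zero; suc; _+_; _*_; _∸_; _^_; _⊔_; NonZero)
open import Data.Nat.DivMod using (_mod_)
open import Data.Fin using (Fin; toℕ)
open import Data.Fin.Properties using () renaming (_≟_ to _≟ᶠ_)
open import Data.Vec using (Vec; []; _∷_; zipWith; replicate; foldr)
open import Data.Vec.Properties using (≡-dec)
open import Data.List using (List; []; _∷_; concatMap; map; filter; length; allFin)
open import Data.Integer using (ℤ; +_) renaming (_+_ to _+ℤ_; _*_ to _*ℤ_; _-_ to _-ℤ_)
open import Data.Product using (∃)
open import Data.Sum using (_⊎_)
open import Relation.Binary.PropositionalEquality using (_≡_)
open import Relation.Nullary using (¬_; Dec)

module _ (p : ℕ) .{{_ : NonZero p}} where

  Fp : Set
  Fp = Fin p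

  infixl 6 _+ₚ_ _-ₚ_
  infixl 7 _*ₚ_

  _+ₚ_ : Fp → Fp → Fp
  a +ₚ b = (toℕ a + toℕ b) mod p

  _-ₚ_ : Fp → Fp → Fp
  a -ₚ b = (toℕ a + (p ∸ toℕ b)) mod p

  _*ₚ_ : Fp → Fp → Fp
  a *ₚ b = (toℕ a * toℕ b) mod p

  0ₚ : Fp
  0ₚ = 0 mod p

  V : ℕ → Set
  V n = Vec Fp n

  _+ᵥ_ : ∀ {n} → V n → V n → V n
  _+ᵥ_ = zipWith _+ₚ_

  _-ᵥ_ : ∀ {n} → V n → V n → V n
  _-ᵥ_ = zipWith _-ₚ_

  0ᵥ : ∀ {n} → V n
  0ᵥ = replicate _ 0ₚ

  ⟨_,_⟩ : ∀ {n} → V n → V n → Fp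
  ⟨ a , x ⟩ = foldr _ _+ₚ_ 0ₚ (zipWith _*ₚ_ a x)

  _≟ᵥ_ : ∀ {n} (u v : V n) → Dec (u ≡ v)
  _≟ᵥ_ = ≡-dec _≟ᶠ_

  allVecs : (n : ℕ) → List (V n)
  allVecs zero = [] ∷ []
  allVecs (suc n) = concatMap (λ c → map (c ∷_) (allVecs n)) (allFin p)

  -- The ring Z[ζ_p] ⊂ ℂ, ζ_p = e^{2πi/p}.
  -- An element Σ_k c_k ζ^k is given by its coefficient function c : Fin p → ℤ.
  -- For p prime the kernel of Z^p → Z[ζ_p] consists of the constant
  -- coefficient vectors (1+ζ+…+ζ^{p-1} = 0 is the only relation), so two
  -- coefficient functions denote the same complex number iff their
  -- difference is constant.
  Zζ : Set
  Zζ = Fp → ℤ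

  _≈ζ_ : Zζ → Zζ → Set
  u ≈ζ v = ∃ λ (m : ℤ) → ∀ k → u k -ℤ v k ≡ m

  const : ℤ → Zζ
  const c k with toℕ k
  ... | zero = c
  ... | suc _ = + 0

  sumFin : (Fp → ℤ) → ℤ
  sumFin g = Data.List.foldr (λ k s → g k +ℤ s) (+ 0) (allFin p)

  -- |w|^2 = w · conj(w), where conj(ζ^k) = ζ^{-k};
  -- coefficient of ζ^d is Σ_k w_{k+d} w_k.
  normSq : Zζ → Zζ
  normSq w d = sumFin (λ k → w (k +ₚ d) *ℤ w k)

  count : ∀ {n} {P : V n → Set} → ((x : V n) → Dec (P x)) → ℕ
  count {n} P? = length (filter P? (allVecs n))

  -- Walsh transform W_f(a) = Σ_x ζ^{f(x) - <a,x>} as an element of Z[ζ_p]: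
  -- the coefficient of ζ^k is #{x : f(x) - <a,x> = k}.
  Walsh : ∀ {n} → (V n → Fp) → V n → Zζ
  Walsh f a k = + count (λ x → (f x -ₚ ⟨ a , x ⟩) ≟ᶠ k)

  -- f is t-plateaued: |W_f(a)| ∈ {0, p^{(n+t)/2}} for all a,
  -- i.e. W_f(a) = 0 or |W_f(a)|^2 = p^{n+t}.
  IsPlateauedFn : (n t : ℕ) → (V n → Fp) → Set
  IsPlateauedFn n t f =
    ∀ a → (Walsh f a ≈ζ const (+ 0)) ⊎ (normSq (Walsh f a) ≈ζ const (+ (p ^ (n + t))))

  component : ∀ {n} → (V n → V n) → V n → (V n → Fp)
  component F b x = ⟨ b , F x ⟩

  IsPlateaued : (n t : ℕ) → (V n → V n) → Set
  IsPlateaued n t F = ∀ (b : V n) → ¬ (b ≡ 0ᵥ) → IsPlateauedFn n t (component F b)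

  diffCount : ∀ {n} → (V n → V n) → V n → V n → ℕ
  diffCount F a b = count (λ x → (F (x +ᵥ a) -ᵥ F x) ≟ᵥ b)

  maxList : List ℕ → ℕ
  maxList = Data.List.foldr _⊔_ 0

  nonzeroVecs : (n : ℕ) → List (V n)
  nonzeroVecs n = filter (λ a → Relation.Nullary.¬? (a ≟ᵥ 0ᵥ)) (allVecs n)

  diffUniformity : ∀ {n} → (V n → V n) → ℕ
  diffUniformity {n} F =
    maxList (concatMap (λ a → map (diffCount F a) (allVecs n)) (nonzeroVecs n))

-- Let N(a,b) be the number of solutions of F(x + a) − F(x) = b. For a nonzero u, the fourth moment
-- Σ_c |W(c)|⁴ of the Walsh spectrum of the component ⟨u, F⟩ counts, up to the factor p^n, the
-- triples (y, y′, a) with ⟨u, F(y + a) − F(y) − F(y′ + a) + F(y′)⟩ = 0; plateauedness gives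
-- |W|⁴ = p^{n+t} |W|², and Parseval then fixes this count. Summing over all u, orthogonality of
-- characters yields Σ_{a,b} N(a,b)² = p^{2n} + (p^n − 1) p^{n+t}, whereas Σ_b N(a,b) = p^n. Hence
-- over a ≠ 0 the N(a,b) satisfy Σ N² = p^t Σ N, so max N ≥ p^t, with equality exactly when every
-- N(a,b) is 0 or p^t. The Walsh values live in ℤ[ζ_p]; only integer sums over their Galois
-- conjugates are used.

module Submission where

open import Defs
open import Data.Nat using (ℕ; _≤_; _<_; _^_; NonZero)
open import Data.Nat.Primality using (Prime)
open import Data.Product using (_×_; _,_)
open import Data.Sum using (_⊎_)
open import Function.Bundles using (_⇔_)
open import Relation.Binary.PropositionalEquality using (_≡_)
open import Relation.Nullary using (¬_)

import Data.Nat as ℕ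
import Data.Nat.Properties as ℕ
open import Data.Nat.DivMod using (_%_; _mod_; %-distribˡ-+; %-distribˡ-*; m<n⇒m%n≡m; n%n≡0; m*n%n≡0)
open import Data.Nat.Coprimality using (coprime-Bézout; prime⇒coprime)
open import Data.Nat.GCD using (module Bézout)
open import Data.Nat.ListAction using (sum)
open import Data.Nat.Primality using (prime⇒nonTrivial)
open import Data.Bool using (true; false; if_then_else_)
open import Data.Fin using (Fin; zero; suc; toℕ)
import Data.Fin.Properties as Fin
open import Data.List as List using (List; []; _∷_; _++_; map; concatMap; filter; length; allFin)
import Data.List.Properties as List
open import Data.List.Membership.Propositional using (_∈_)
open import Data.List.Membership.Propositional.Properties using (∈-filter⁺; ∈-filter⁻)
open import Data.List.Relation.Unary.Any using (here; there)
open import Data.List.Relation.Unary.All using (All)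
import Data.List.Relation.Unary.All as All
import Data.List.Relation.Unary.All.Properties as All
open import Data.Vec using ([]; _∷_)
open import Data.Vec.Properties using (∷-injective)
open import Data.Maybe using (Maybe; just; nothing)
open import Data.Product using (∃; proj₁; proj₂)
open import Data.Sum using (inj₁; inj₂)
open import Function using (id)
open import Function.Bundles using (mk⇔; Equivalence)
open import Function.Construct.Composition using (_⇔-∘_)
open import Function.Construct.Symmetry using (⇔-sym)
open import Level using (0ℓ)
open import Relation.Binary.Definitions using (DecidableEquality)
open import Relation.Binary.PropositionalEquality
  using (_≢_; refl; sym; trans; cong; cong₂; subst; isEquivalence; module ≡-Reasoning)
open import Relation.Nullary using (Dec; yes; no; does; ¬?; contradiction)
open import Relation.Nullary.Decidable using (_×-dec_)
open import Algebra.Bundles using (CommutativeRing)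
open import Algebra.Structures using (IsCommutativeRing)
open import Algebra.Consequences.Propositional using (comm∧assoc⇒middleFour)
import Algebra.Properties.AbelianGroup as AbelianGroupProperties
import Algebra.Properties.Ring as RingProperties
import Algebra.Solver.Ring
import Algebra.Solver.Ring.AlmostCommutativeRing as ACR

module NatLists where

  open import Data.Nat
  open import Data.Nat.Properties
  open import Data.List using (foldr)
  open import Data.List.Relation.Unary.All using ([]; _∷_)

  -- Defs.maxList, without its unused characteristic parameter.
  maximum : List ℕ → ℕ
  maximum = foldr _⊔_ 0

  sumSq : List ℕ → ℕ
  sumSq xs = sum (map (λ x → x * x) xs)

  ≤-maximum : ∀ xs → All (_≤ maximum xs) xs
  ≤-maximum []       = []
  ≤-maximum (x ∷ xs) = m≤m⊔n x (maximum xs) ∷ All.map (λ x≤ → ≤-trans x≤ (m≤n⊔m x (maximum xs))) (≤-maximum xs)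

  maximum-≤ : ∀ {M} xs → All (_≤ M) xs → maximum xs ≤ M
  maximum-≤ []       []         = z≤n
  maximum-≤ (x ∷ xs) (x≤ ∷ xs≤) = ⊔-lub x≤ (maximum-≤ xs xs≤)

  sumSq-≤ : ∀ {M} xs → All (_≤ M) xs → sumSq xs ≤ M * sum xs
  sumSq-≤ []           []         = z≤n
  sumSq-≤ {M} (x ∷ xs) (x≤ ∷ xs≤) = ≤-trans (+-mono-≤ (*-monoˡ-≤ x x≤) (sumSq-≤ xs xs≤))
                                            (≤-reflexive (sym (*-distribˡ-+ M x (sum xs))))

  sumSq-tight : ∀ T xs → All (_≤ T) xs → sumSq xs ≡ T * sum xs → All (λ x → x * x ≡ T * x) xs
  sumSq-tight T []       []         _ = []
  sumSq-tight T (x ∷ xs) (x≤ ∷ xs≤) eq = x²≡Tx ∷ sumSq-tight T xs xs≤ rest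
    where
    eq′ : x * x + sumSq xs ≡ T * x + T * sum xs
    eq′ = trans eq (*-distribˡ-+ T x (sum xs))
    x²≤Tx : x * x ≤ T * x
    x²≤Tx = *-monoˡ-≤ x x≤
    x²≡Tx : x * x ≡ T * x
    x²≡Tx = ≤-antisym x²≤Tx (+-cancelʳ-≤ (T * sum xs) (T * x) (x * x)
              (≤-trans (≤-reflexive (sym eq′)) (+-monoʳ-≤ (x * x) (sumSq-≤ xs xs≤))))
    rest : sumSq xs ≡ T * sum xs
    rest = +-cancelˡ-≡ (x * x) (sumSq xs) (T * sum xs) (trans eq′ (cong (_+ T * sum xs) (sym x²≡Tx)))

  maximum-≥ : ∀ T xs → sumSq xs ≡ T * sum xs → sum xs ≢ 0 → T ≤ maximum xs
  maximum-≥ T xs eq sum≢0 = *-cancelʳ-≤ T (maximum xs) (sum xs) {{≢-nonZero sum≢0}}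
    (≤-trans (≤-reflexive (sym eq)) (sumSq-≤ xs (≤-maximum xs)))

  maximum≡⇔ : ∀ T xs → sumSq xs ≡ T * sum xs → sum xs ≢ 0 →
              (maximum xs ≡ T) ⇔ All (λ x → x ≡ 0 ⊎ x ≡ T) xs
  maximum≡⇔ T xs eq sum≢0 = mk⇔ to from
    where
    root : ∀ x → x * x ≡ T * x → x ≡ 0 ⊎ x ≡ T
    root zero    _   = inj₁ refl
    root (suc k) x²≡ = inj₂ (*-cancelʳ-≡ (suc k) T (suc k) x²≡)
    to : maximum xs ≡ T → All (λ x → x ≡ 0 ⊎ x ≡ T) xs
    to max≡T = All.map (λ {x} → root x)
      (sumSq-tight T xs (subst (λ M → All (_≤ M) xs) max≡T (≤-maximum xs)) eq)
    from : All (λ x → x ≡ 0 ⊎ x ≡ T) xs → maximum xs ≡ T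
    from values = ≤-antisym
      (maximum-≤ xs (All.map (λ { (inj₁ refl) → z≤n ; (inj₂ refl) → ≤-refl }) values))
      (maximum-≥ T xs eq sum≢0)

open NatLists using (sumSq; maximum-≥; maximum≡⇔)

open import Data.Integer as ℤ using (ℤ; +_; -[1+_]; 0ℤ; 1ℤ; _+_; _*_; _-_; -_)
import Data.Integer.Properties as ℤ
open import Data.Integer.Tactic.RingSolver using (solve-∀)

∑ : {A : Set} → List A → (A → ℤ) → ℤ
∑ xs f = List.foldr (λ x s → f x + s) 0ℤ xs

syntax ∑ xs (λ x → e) = ∑[ x ← xs ] e

⟦_⟧ : {P : Set} → Dec P → ℤ
⟦ P? ⟧ = if does P? then 1ℤ else 0ℤ

module _ {P : Set} where

  ⟦⟧-yes : (P? : Dec P) → P → ⟦ P? ⟧ ≡ 1ℤ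
  ⟦⟧-yes (yes _) _  = refl
  ⟦⟧-yes (no ¬p) p  = contradiction p ¬p

  ⟦⟧-no : (P? : Dec P) → ¬ P → ⟦ P? ⟧ ≡ 0ℤ
  ⟦⟧-no (yes p) ¬p = contradiction p ¬p
  ⟦⟧-no (no _)  _  = refl

  ⟦⟧-idem : (P? : Dec P) → ⟦ P? ⟧ * ⟦ P? ⟧ ≡ ⟦ P? ⟧
  ⟦⟧-idem (yes _) = refl
  ⟦⟧-idem (no _)  = refl

  ⟦⟧-¬ : (P? : Dec P) → ⟦ ¬? P? ⟧ ≡ 1ℤ - ⟦ P? ⟧
  ⟦⟧-¬ (yes _) = refl
  ⟦⟧-¬ (no _)  = refl

module _ {P Q : Set} where

  ⟦⟧-cong : (P? : Dec P) (Q? : Dec Q) → P ⇔ Q → ⟦ P? ⟧ ≡ ⟦ Q? ⟧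
  ⟦⟧-cong (yes p) Q? P⇔Q = sym (⟦⟧-yes Q? (Equivalence.to P⇔Q p))
  ⟦⟧-cong (no ¬p) Q? P⇔Q = sym (⟦⟧-no Q? (λ q → ¬p (Equivalence.from P⇔Q q)))

  ⟦⟧-× : (P? : Dec P) (Q? : Dec Q) → ⟦ P? ⟧ * ⟦ Q? ⟧ ≡ ⟦ P? ×-dec Q? ⟧
  ⟦⟧-× (yes _) (yes _) = refl
  ⟦⟧-× (yes _) (no _)  = refl
  ⟦⟧-× (no _)  _       = refl

module _ {A : Set} where

  ∑-cong : ∀ (xs : List A) {f g : A → ℤ} → (∀ x → f x ≡ g x) → ∑ xs f ≡ ∑ xs g
  ∑-cong []       f≗g = refl
  ∑-cong (x ∷ xs) f≗g = cong₂ _+_ (f≗g x) (∑-cong xs f≗g)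

  ∑-distrib-+ : ∀ (xs : List A) (f g : A → ℤ) → ∑[ x ← xs ] (f x + g x) ≡ ∑ xs f + ∑ xs g
  ∑-distrib-+ []       f g = refl
  ∑-distrib-+ (x ∷ xs) f g = trans (cong (_+_ (f x + g x)) (∑-distrib-+ xs f g))
                                   (shuffle (f x) (g x) (∑ xs f) (∑ xs g))
    where
    shuffle : ∀ a b c d → a + b + (c + d) ≡ a + c + (b + d)
    shuffle = solve-∀

  ∑-distrib-neg : ∀ (xs : List A) (f : A → ℤ) → ∑[ x ← xs ] (- f x) ≡ - ∑ xs f
  ∑-distrib-neg []       f = refl
  ∑-distrib-neg (x ∷ xs) f = trans (cong (_+_ (- f x)) (∑-distrib-neg xs f)) (sym (ℤ.neg-distrib-+ (f x) _))

  ∑-distrib-- : ∀ (xs : List A) (f g : A → ℤ) → ∑[ x ← xs ] (f x - g x) ≡ ∑ xs f - ∑ xs g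
  ∑-distrib-- xs f g = trans (∑-distrib-+ xs f (λ x → - g x)) (cong (_+_ (∑ xs f)) (∑-distrib-neg xs g))

  *-distribˡ-∑ : ∀ (xs : List A) c (f : A → ℤ) → c * ∑ xs f ≡ ∑[ x ← xs ] (c * f x)
  *-distribˡ-∑ []       c f = ℤ.*-zeroʳ c
  *-distribˡ-∑ (x ∷ xs) c f = trans (ℤ.*-distribˡ-+ c (f x) _) (cong (_+_ (c * f x)) (*-distribˡ-∑ xs c f))

  *-distribʳ-∑ : ∀ (xs : List A) c (f : A → ℤ) → ∑ xs f * c ≡ ∑[ x ← xs ] (f x * c)
  *-distribʳ-∑ xs c f = trans (ℤ.*-comm (∑ xs f) c)
    (trans (*-distribˡ-∑ xs c f) (∑-cong xs (λ x → ℤ.*-comm c (f x))))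

  ∑-linear : ∀ (xs : List A) c (f g : A → ℤ) → c * ∑ xs f - ∑ xs g ≡ ∑[ x ← xs ] (c * f x - g x)
  ∑-linear xs c f g = trans (cong (_- ∑ xs g) (*-distribˡ-∑ xs c f))
                            (sym (∑-distrib-- xs (λ x → c * f x) g))

  ∑-const : ∀ (xs : List A) c → ∑[ _ ← xs ] c ≡ + length xs * c
  ∑-const []       c = refl
  ∑-const (x ∷ xs) c = trans (cong (_+_ c) (∑-const xs c)) (sym (ℤ.suc-* (+ length xs) c))

  ∑-zero : ∀ (xs : List A) → ∑[ _ ← xs ] 0ℤ ≡ 0ℤ
  ∑-zero []       = refl
  ∑-zero (x ∷ xs) = trans (ℤ.+-identityˡ _) (∑-zero xs)

  ∑-++ : ∀ (xs ys : List A) (f : A → ℤ) → ∑ (xs ++ ys) f ≡ ∑ xs f + ∑ ys f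
  ∑-++ []       ys f = sym (ℤ.+-identityˡ _)
  ∑-++ (x ∷ xs) ys f = trans (cong (_+_ (f x)) (∑-++ xs ys f)) (sym (ℤ.+-assoc (f x) _ _))

  ∑-map : ∀ {B : Set} (g : B → A) (ys : List B) (f : A → ℤ) → ∑ (map g ys) f ≡ ∑[ y ← ys ] f (g y)
  ∑-map g []       f = refl
  ∑-map g (y ∷ ys) f = cong (_+_ (f (g y))) (∑-map g ys f)

  ∑-concatMap : ∀ {B : Set} (g : B → List A) (ys : List B) (f : A → ℤ) →
                ∑ (concatMap g ys) f ≡ ∑[ y ← ys ] ∑ (g y) f
  ∑-concatMap g []       f = refl
  ∑-concatMap g (y ∷ ys) f = trans (∑-++ (g y) (concatMap g ys) f) (cong (_+_ (∑ (g y) f)) (∑-concatMap g ys f))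

  ∑-filter : ∀ {P : A → Set} (P? : ∀ x → Dec (P x)) (xs : List A) (f : A → ℤ) →
             ∑ (filter P? xs) f ≡ ∑[ x ← xs ] (⟦ P? x ⟧ * f x)
  ∑-filter P? []       f = refl
  ∑-filter P? (x ∷ xs) f with does (P? x)
  ... | true  = cong₂ _+_ (sym (ℤ.*-identityˡ (f x))) (∑-filter P? xs f)
  ... | false = trans (∑-filter P? xs f) (sym (ℤ.+-identityˡ _))

  length-filter : ∀ {P : A → Set} (P? : ∀ x → Dec (P x)) (xs : List A) →
                  + length (filter P? xs) ≡ ∑[ x ← xs ] ⟦ P? x ⟧
  length-filter P? xs = begin
    + length (filter P? xs)                 ≡⟨ ℤ.*-identityʳ _ ⟨
    + length (filter P? xs) * 1ℤ            ≡⟨ ∑-const (filter P? xs) 1ℤ ⟨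
    ∑[ _ ← filter P? xs ] 1ℤ                ≡⟨ ∑-filter P? xs (λ _ → 1ℤ) ⟩
    ∑[ x ← xs ] (⟦ P? x ⟧ * 1ℤ)             ≡⟨ ∑-cong xs (λ x → ℤ.*-identityʳ ⟦ P? x ⟧) ⟩
    ∑[ x ← xs ] ⟦ P? x ⟧                    ∎
    where open ≡-Reasoning

module _ {A B : Set} where

  ∑-comm : ∀ (xs : List A) (ys : List B) (f : A → B → ℤ) →
           ∑[ x ← xs ] ∑[ y ← ys ] f x y ≡ ∑[ y ← ys ] ∑[ x ← xs ] f x y
  ∑-comm []       ys f = sym (∑-zero ys)
  ∑-comm (x ∷ xs) ys f = trans (cong (_+_ (∑ ys (f x))) (∑-comm xs ys f))
                               (sym (∑-distrib-+ ys (f x) (λ y → ∑[ x′ ← xs ] f x′ y)))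

  ∑-*-∑ : ∀ (xs : List A) (ys : List B) (f : A → ℤ) (g : B → ℤ) →
          ∑ xs f * ∑ ys g ≡ ∑[ x ← xs ] ∑[ y ← ys ] (f x * g y)
  ∑-*-∑ xs ys f g = trans (*-distribʳ-∑ xs (∑ ys g) f) (∑-cong xs (λ x → *-distribˡ-∑ ys (f x) g))

∑-pos : ∀ (xs : List ℕ) → ∑[ x ← xs ] (+ x) ≡ + sum xs
∑-pos []       = refl
∑-pos (x ∷ xs) = trans (cong (_+_ (+ x)) (∑-pos xs)) (sym (ℤ.pos-+ x (sum xs)))

∑-pos-square : ∀ (xs : List ℕ) → ∑[ x ← xs ] (+ x * + x) ≡ + sum (map (λ x → x ℕ.* x) xs)
∑-pos-square []       = refl
∑-pos-square (x ∷ xs) = trans (cong₂ _+_ (sym (ℤ.pos-* x x)) (∑-pos-square xs)) (sym (ℤ.pos-+ (x ℕ.* x) _))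

module Enumeration {A : Set} (_≟_ : DecidableEquality A) where

  Enumerates : List A → Set
  Enumerates xs = ∀ y → ∑[ x ← xs ] ⟦ x ≟ y ⟧ ≡ 1ℤ

  ∑-sift : ∀ xs → Enumerates xs → ∀ y (h : A → ℤ) → ∑[ x ← xs ] (⟦ x ≟ y ⟧ * h x) ≡ h y
  ∑-sift xs enum y h = begin
    ∑[ x ← xs ] (⟦ x ≟ y ⟧ * h x)       ≡⟨ ∑-cong xs pointwise ⟩
    ∑[ x ← xs ] (⟦ x ≟ y ⟧ * h y)       ≡⟨ *-distribʳ-∑ xs (h y) (λ x → ⟦ x ≟ y ⟧) ⟨
    ∑[ x ← xs ] ⟦ x ≟ y ⟧ * h y         ≡⟨ cong (_* h y) (enum y) ⟩
    1ℤ * h y                            ≡⟨ ℤ.*-identityˡ (h y) ⟩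
    h y                                 ∎
    where
    open ≡-Reasoning
    pointwise : ∀ x → ⟦ x ≟ y ⟧ * h x ≡ ⟦ x ≟ y ⟧ * h y
    pointwise x with x ≟ y
    ... | yes refl = refl
    ... | no _     = refl

  ∑-⟦≟⟧≡1⇒∈ : ∀ xs y → ∑[ x ← xs ] ⟦ x ≟ y ⟧ ≡ 1ℤ → y ∈ xs
  ∑-⟦≟⟧≡1⇒∈ []       y ()
  ∑-⟦≟⟧≡1⇒∈ (x ∷ xs) y ∑≡1 with x ≟ y
  ... | yes refl = here refl
  ... | no _     = there (∑-⟦≟⟧≡1⇒∈ xs y (trans (sym (ℤ.+-identityˡ _)) ∑≡1))

  ∑-⟦≟⟧ʳ : ∀ xs → Enumerates xs → ∀ y → ∑[ x ← xs ] ⟦ y ≟ x ⟧ ≡ 1ℤ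
  ∑-⟦≟⟧ʳ xs enum y = trans (∑-cong xs (λ x → ⟦⟧-cong (y ≟ x) (x ≟ y) (mk⇔ sym sym))) (enum y)

  ∑-⟦≟⟧*⟦≟⟧ : ∀ xs → Enumerates xs → ∀ a b → ∑[ x ← xs ] (⟦ a ≟ x ⟧ * ⟦ b ≟ x ⟧) ≡ ⟦ a ≟ b ⟧
  ∑-⟦≟⟧*⟦≟⟧ xs enum a b = begin
    ∑[ x ← xs ] (⟦ a ≟ x ⟧ * ⟦ b ≟ x ⟧)   ≡⟨ ∑-cong xs (λ x → trans (ℤ.*-comm ⟦ a ≟ x ⟧ ⟦ b ≟ x ⟧)
                                                (cong (_* ⟦ a ≟ x ⟧) (⟦⟧-cong (b ≟ x) (x ≟ b) (mk⇔ sym sym)))) ⟩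
    ∑[ x ← xs ] (⟦ x ≟ b ⟧ * ⟦ a ≟ x ⟧)   ≡⟨ ∑-sift xs enum b (λ x → ⟦ a ≟ x ⟧) ⟩
    ⟦ a ≟ b ⟧                             ∎
    where open ≡-Reasoning

  ∑-reindex : ∀ xs → Enumerates xs → (σ τ : A → A) → (∀ x z → (z ≡ σ x) ⇔ (x ≡ τ z)) →
              (h : A → ℤ) → ∑[ x ← xs ] h (σ x) ≡ ∑ xs h
  ∑-reindex xs enum σ τ inverse h = begin
    ∑[ x ← xs ] h (σ x)                              ≡⟨ ∑-cong xs (λ x → ∑-sift xs enum (σ x) h) ⟨
    ∑[ x ← xs ] ∑[ z ← xs ] (⟦ z ≟ σ x ⟧ * h z)      ≡⟨ ∑-comm xs xs (λ x z → ⟦ z ≟ σ x ⟧ * h z) ⟩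
    ∑[ z ← xs ] ∑[ x ← xs ] (⟦ z ≟ σ x ⟧ * h z)      ≡⟨ ∑-cong xs (λ z → ∑-cong xs (λ x →
                                                           cong (_* h z) (⟦⟧-cong (z ≟ σ x) (x ≟ τ z) (inverse x z)))) ⟩
    ∑[ z ← xs ] ∑[ x ← xs ] (⟦ x ≟ τ z ⟧ * h z)      ≡⟨ ∑-cong xs (λ z → ∑-sift xs enum (τ z) (λ _ → h z)) ⟩
    ∑ xs h                                           ∎
    where open ≡-Reasoning

module DoubleSum {Y Z : Set} (ys : List Y) (zs : List Z) where

  ∑₂ : (Y → Z → ℤ) → ℤ
  ∑₂ h = ∑[ y ← ys ] ∑[ z ← zs ] h y z

  ∑₂-cong : ∀ {f g : Y → Z → ℤ} → (∀ y z → f y z ≡ g y z) → ∑₂ f ≡ ∑₂ g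
  ∑₂-cong f≗g = ∑-cong ys (λ y → ∑-cong zs (f≗g y))

  ∑₂-linear : ∀ c (f g : Y → Z → ℤ) → c * ∑₂ f - ∑₂ g ≡ ∑₂ (λ y z → c * f y z - g y z)
  ∑₂-linear c f g = trans (∑-linear ys c (λ y → ∑ zs (f y)) (λ y → ∑ zs (g y)))
                          (∑-cong ys (λ y → ∑-linear zs c (f y) (g y)))

  *-distribˡ-∑₂ : ∀ c (f : Y → Z → ℤ) → c * ∑₂ f ≡ ∑₂ (λ y z → c * f y z)
  *-distribˡ-∑₂ c f = trans (*-distribˡ-∑ ys c (λ y → ∑ zs (f y))) (∑-cong ys (λ y → *-distribˡ-∑ zs c (f y)))

  ∑-∑₂-comm : ∀ {W : Set} (ws : List W) (h : W → Y → Z → ℤ) →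
              ∑[ w ← ws ] ∑₂ (h w) ≡ ∑₂ (λ y z → ∑[ w ← ws ] h w y z)
  ∑-∑₂-comm ws h = trans (∑-comm ws ys (λ w y → ∑ zs (h w y))) (∑-cong ys (λ y → ∑-comm ws zs (λ w → h w y)))

  ∑₂-*-∑₂ : ∀ (f g : Y → Z → ℤ) → ∑₂ f * ∑₂ g ≡ ∑₂ (λ y z → ∑₂ (λ y′ z′ → f y z * g y′ z′))
  ∑₂-*-∑₂ f g = begin
    ∑₂ f * ∑₂ g
      ≡⟨ ∑-*-∑ ys ys (λ y → ∑ zs (f y)) (λ y′ → ∑ zs (g y′)) ⟩
    ∑[ y ← ys ] ∑[ y′ ← ys ] (∑ zs (f y) * ∑ zs (g y′))
      ≡⟨ ∑-cong ys (λ y → ∑-cong ys (λ y′ → ∑-*-∑ zs zs (f y) (g y′))) ⟩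
    ∑[ y ← ys ] ∑[ y′ ← ys ] ∑[ z ← zs ] ∑[ z′ ← zs ] (f y z * g y′ z′)
      ≡⟨ ∑-cong ys (λ y → ∑-comm ys zs (λ y′ z → ∑[ z′ ← zs ] (f y z * g y′ z′))) ⟩
    ∑₂ (λ y z → ∑₂ (λ y′ z′ → f y z * g y′ z′)) ∎
    where open ≡-Reasoning

module PrimeField (p : ℕ) .{{_ : NonZero p}} where

  Fₚ : Set
  Fₚ = Fp p

  infixl 6 _⊕_ _⊖_
  infixl 7 _⊛_
  infix  8 ⊝_

  _⊕_ _⊖_ _⊛_ : Fₚ → Fₚ → Fₚ
  _⊕_ = _+ₚ_ p
  _⊖_ = _-ₚ_ p
  _⊛_ = _*ₚ_ p

  𝟘 𝟙 : Fₚ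
  𝟘 = 0ₚ p
  𝟙 = 1 mod p

  ⊝_ : Fₚ → Fₚ
  ⊝ a = 𝟘 ⊖ a

  infix 4 _≟ₚ_
  _≟ₚ_ : DecidableEquality Fₚ
  _≟ₚ_ = Fin._≟_

  toℕ-mod : ∀ m → toℕ (m mod p) ≡ m % p
  toℕ-mod m = Fin.toℕ-fromℕ< _

  mod-toℕ : ∀ a → toℕ a mod p ≡ a
  mod-toℕ a = Fin.toℕ-injective (trans (toℕ-mod (toℕ a)) (m<n⇒m%n≡m (Fin.toℕ<n a)))

  mod-cong : ∀ {m n} → m % p ≡ n % p → m mod p ≡ n mod p
  mod-cong {m} {n} e = Fin.toℕ-injective (trans (toℕ-mod m) (trans e (sym (toℕ-mod n))))

  toℕ-𝟘 : toℕ 𝟘 ≡ 0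
  toℕ-𝟘 = trans (toℕ-mod 0) (m<n⇒m%n≡m (ℕ.>-nonZero⁻¹ p))

  mod-+ : ∀ m n → (m ℕ.+ n) mod p ≡ (m mod p) ⊕ (n mod p)
  mod-+ m n = mod-cong (begin
      (m ℕ.+ n) % p                                ≡⟨ %-distribˡ-+ m n p ⟩
      (m % p ℕ.+ n % p) % p                        ≡⟨ cong₂ (λ x y → (x ℕ.+ y) % p) (toℕ-mod m) (toℕ-mod n) ⟨
      (toℕ (m mod p) ℕ.+ toℕ (n mod p)) % p        ∎)
    where open ≡-Reasoning

  mod-* : ∀ m n → (m ℕ.* n) mod p ≡ (m mod p) ⊛ (n mod p)
  mod-* m n = mod-cong (begin
      (m ℕ.* n) % p                                ≡⟨ %-distribˡ-* m n p ⟩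
      (m % p ℕ.* (n % p)) % p                      ≡⟨ cong₂ (λ x y → (x ℕ.* y) % p) (toℕ-mod m) (toℕ-mod n) ⟨
      (toℕ (m mod p) ℕ.* toℕ (n mod p)) % p        ∎)
    where open ≡-Reasoning

  ⊕-mod : ∀ a m → a ⊕ (m mod p) ≡ (toℕ a ℕ.+ m) mod p
  ⊕-mod a m = trans (cong (_⊕ (m mod p)) (sym (mod-toℕ a))) (sym (mod-+ (toℕ a) m))

  ⊛-mod : ∀ a m → a ⊛ (m mod p) ≡ (toℕ a ℕ.* m) mod p
  ⊛-mod a m = trans (cong (_⊛ (m mod p)) (sym (mod-toℕ a))) (sym (mod-* (toℕ a) m))

  p-mod : p mod p ≡ 𝟘
  p-mod = Fin.toℕ-injective (trans (toℕ-mod p) (trans (n%n≡0 p) (sym toℕ-𝟘)))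

  ⊖-as-⊕ : ∀ a b → a ⊖ b ≡ a ⊕ ⊝ b
  ⊖-as-⊕ a b = sym (trans (⊕-mod a _) (cong (λ z → (toℕ a ℕ.+ (z ℕ.+ (p ℕ.∸ toℕ b))) mod p) toℕ-𝟘))

  ⊕-comm : ∀ a b → a ⊕ b ≡ b ⊕ a
  ⊕-comm a b = cong (_mod p) (ℕ.+-comm (toℕ a) (toℕ b))

  ⊛-comm : ∀ a b → a ⊛ b ≡ b ⊛ a
  ⊛-comm a b = cong (_mod p) (ℕ.*-comm (toℕ a) (toℕ b))

  ⊕-assoc : ∀ a b c → (a ⊕ b) ⊕ c ≡ a ⊕ (b ⊕ c)
  ⊕-assoc a b c = begin
    (a ⊕ b) ⊕ c                           ≡⟨ trans (⊕-comm _ c) (⊕-mod c _) ⟩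
    (toℕ c ℕ.+ (toℕ a ℕ.+ toℕ b)) mod p   ≡⟨ cong (_mod p) (ℕ.+-comm (toℕ c) _) ⟩
    (toℕ a ℕ.+ toℕ b ℕ.+ toℕ c) mod p     ≡⟨ cong (_mod p) (ℕ.+-assoc (toℕ a) _ _) ⟩
    (toℕ a ℕ.+ (toℕ b ℕ.+ toℕ c)) mod p   ≡⟨ ⊕-mod a _ ⟨
    a ⊕ (b ⊕ c)                           ∎
    where open ≡-Reasoning

  ⊛-assoc : ∀ a b c → (a ⊛ b) ⊛ c ≡ a ⊛ (b ⊛ c)
  ⊛-assoc a b c = begin
    (a ⊛ b) ⊛ c                           ≡⟨ trans (⊛-comm _ c) (⊛-mod c _) ⟩
    (toℕ c ℕ.* (toℕ a ℕ.* toℕ b)) mod p   ≡⟨ cong (_mod p) (ℕ.*-comm (toℕ c) _) ⟩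
    (toℕ a ℕ.* toℕ b ℕ.* toℕ c) mod p     ≡⟨ cong (_mod p) (ℕ.*-assoc (toℕ a) _ _) ⟩
    (toℕ a ℕ.* (toℕ b ℕ.* toℕ c)) mod p   ≡⟨ ⊛-mod a _ ⟨
    a ⊛ (b ⊛ c)                           ∎
    where open ≡-Reasoning

  ⊛-distribˡ-⊕ : ∀ a b c → a ⊛ (b ⊕ c) ≡ a ⊛ b ⊕ a ⊛ c
  ⊛-distribˡ-⊕ a b c = begin
    a ⊛ (b ⊕ c)                                        ≡⟨ ⊛-mod a _ ⟩
    (toℕ a ℕ.* (toℕ b ℕ.+ toℕ c)) mod p                ≡⟨ cong (_mod p) (ℕ.*-distribˡ-+ (toℕ a) (toℕ b) _) ⟩
    (toℕ a ℕ.* toℕ b ℕ.+ toℕ a ℕ.* toℕ c) mod p        ≡⟨ mod-+ _ _ ⟩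
    a ⊛ b ⊕ a ⊛ c                                      ∎
    where open ≡-Reasoning

  ⊕-identityˡ : ∀ a → 𝟘 ⊕ a ≡ a
  ⊕-identityˡ a = trans (cong (λ z → (z ℕ.+ toℕ a) mod p) toℕ-𝟘) (mod-toℕ a)

  ⊛-identityˡ : ∀ a → 𝟙 ⊛ a ≡ a
  ⊛-identityˡ a = begin
    𝟙 ⊛ a                         ≡⟨ cong (𝟙 ⊛_) (mod-toℕ a) ⟨
    𝟙 ⊛ (toℕ a mod p)             ≡⟨ mod-* 1 (toℕ a) ⟨
    (1 ℕ.* toℕ a) mod p           ≡⟨ cong (_mod p) (ℕ.*-identityˡ (toℕ a)) ⟩
    toℕ a mod p                   ≡⟨ mod-toℕ a ⟩
    a                             ∎
    where open ≡-Reasoning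

  ⊕-inverseʳ : ∀ a → a ⊕ ⊝ a ≡ 𝟘
  ⊕-inverseʳ a = begin
    a ⊕ ⊝ a                                       ≡⟨ ⊕-mod a _ ⟩
    (toℕ a ℕ.+ (toℕ 𝟘 ℕ.+ (p ℕ.∸ toℕ a))) mod p   ≡⟨ cong (λ z → (toℕ a ℕ.+ (z ℕ.+ (p ℕ.∸ toℕ a))) mod p) toℕ-𝟘 ⟩
    (toℕ a ℕ.+ (p ℕ.∸ toℕ a)) mod p               ≡⟨ cong (_mod p) (ℕ.m+[n∸m]≡n (ℕ.<⇒≤ (Fin.toℕ<n a))) ⟩
    p mod p                                       ≡⟨ p-mod ⟩
    𝟘                                             ∎
    where open ≡-Reasoning

  +-*-isCommutativeRing : IsCommutativeRing _≡_ _⊕_ _⊛_ ⊝_ 𝟘 𝟙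
  +-*-isCommutativeRing = record
    { isRing = record
      { +-isAbelianGroup = record
        { isGroup = record
          { isMonoid = record
            { isSemigroup = record
              { isMagma = record { isEquivalence = isEquivalence ; ∙-cong = cong₂ _⊕_ }
              ; assoc   = ⊕-assoc }
            ; identity = ⊕-identityˡ , λ a → trans (⊕-comm a 𝟘) (⊕-identityˡ a) }
          ; inverse = (λ a → trans (⊕-comm (⊝ a) a) (⊕-inverseʳ a)) , ⊕-inverseʳ
          ; ⁻¹-cong = cong ⊝_ }
        ; comm = ⊕-comm }
      ; *-cong     = cong₂ _⊛_
      ; *-assoc    = ⊛-assoc
      ; *-identity = ⊛-identityˡ , λ a → trans (⊛-comm a 𝟙) (⊛-identityˡ a)
      ; distrib    = ⊛-distribˡ-⊕ , λ a b c → trans (⊛-comm (b ⊕ c) a)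
                       (trans (⊛-distribˡ-⊕ a b c) (cong₂ _⊕_ (⊛-comm a b) (⊛-comm a c))) }
    ; *-comm = ⊛-comm }

  +-*-commutativeRing : CommutativeRing 0ℓ 0ℓ
  +-*-commutativeRing = record { isCommutativeRing = +-*-isCommutativeRing }

  open CommutativeRing +-*-commutativeRing using (+-abelianGroup; ring; zeroˡ; zeroʳ)
  open AbelianGroupProperties +-abelianGroup using (⁻¹-∙-comm; ε⁻¹≈ε; ⁻¹-involutive; x∙y⁻¹≈ε⇒x≈y; inverseʳ-unique)
  open RingProperties ring using (-‿distribˡ-*)

  ⊕-middleFour : ∀ a b c d → (a ⊕ b) ⊕ (c ⊕ d) ≡ (a ⊕ c) ⊕ (b ⊕ d)
  ⊕-middleFour = comm∧assoc⇒middleFour ⊕-comm ⊕-assoc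

  -- The ring solver takes its coefficients from ℤ, read in Fₚ through fromℤ.
  fromℤ : ℤ → Fₚ
  fromℤ (+ n)      = n mod p
  fromℤ -[1+ n ]   = ⊝ (ℕ.suc n mod p)

  fromℤ-⊖ : ∀ m n → fromℤ (m ℤ.⊖ n) ≡ (m mod p) ⊕ ⊝ (n mod p)
  fromℤ-⊖ m       ℕ.zero    = sym (trans (cong ((m mod p) ⊕_) ε⁻¹≈ε) (trans (⊕-comm _ 𝟘) (⊕-identityˡ _)))
  fromℤ-⊖ ℕ.zero  (ℕ.suc n) = sym (⊕-identityˡ _)
  fromℤ-⊖ (ℕ.suc m) (ℕ.suc n) = begin
    fromℤ (ℕ.suc m ℤ.⊖ ℕ.suc n)                   ≡⟨ cong fromℤ (ℤ.[1+m]⊖[1+n]≡m⊖n m n) ⟩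
    fromℤ (m ℤ.⊖ n)                               ≡⟨ fromℤ-⊖ m n ⟩
    a ⊕ ⊝ b                                       ≡⟨ ⊕-identityˡ _ ⟨
    𝟘 ⊕ (a ⊕ ⊝ b)                                 ≡⟨ cong (_⊕ (a ⊕ ⊝ b)) (⊕-inverseʳ o) ⟨
    (o ⊕ ⊝ o) ⊕ (a ⊕ ⊝ b)                         ≡⟨ ⊕-middleFour o (⊝ o) a (⊝ b) ⟩
    (o ⊕ a) ⊕ (⊝ o ⊕ ⊝ b)                         ≡⟨ cong ((o ⊕ a) ⊕_) (⁻¹-∙-comm o b) ⟩
    (o ⊕ a) ⊕ ⊝ (o ⊕ b)                           ≡⟨ cong₂ (λ x y → x ⊕ ⊝ y) (mod-+ 1 m) (mod-+ 1 n) ⟨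
    (ℕ.suc m mod p) ⊕ ⊝ (ℕ.suc n mod p)           ∎
    where
    open ≡-Reasoning
    o a b : Fₚ
    o = 1 mod p
    a = m mod p
    b = n mod p

  fromℤ-+ : ∀ i j → fromℤ (i ℤ.+ j) ≡ fromℤ i ⊕ fromℤ j
  fromℤ-+ (+ m)      (+ n)      = mod-+ m n
  fromℤ-+ (+ m)      -[1+ n ]   = fromℤ-⊖ m (ℕ.suc n)
  fromℤ-+ -[1+ m ]   (+ n)      = trans (fromℤ-⊖ n (ℕ.suc m)) (⊕-comm (n mod p) (⊝ (ℕ.suc m mod p)))
  fromℤ-+ -[1+ m ]   -[1+ n ]   = begin
    ⊝ (ℕ.suc (ℕ.suc (m ℕ.+ n)) mod p)             ≡⟨ cong (λ z → ⊝ (ℕ.suc z mod p)) (ℕ.+-suc m n) ⟨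
    ⊝ ((ℕ.suc m ℕ.+ ℕ.suc n) mod p)               ≡⟨ cong ⊝_ (mod-+ (ℕ.suc m) (ℕ.suc n)) ⟩
    ⊝ ((ℕ.suc m mod p) ⊕ (ℕ.suc n mod p))         ≡⟨ ⁻¹-∙-comm (ℕ.suc m mod p) (ℕ.suc n mod p) ⟨
    ⊝ (ℕ.suc m mod p) ⊕ ⊝ (ℕ.suc n mod p)         ∎
    where open ≡-Reasoning

  fromℤ-neg : ∀ i → fromℤ (ℤ.- i) ≡ ⊝ fromℤ i
  fromℤ-neg (+ ℕ.zero)  = sym ε⁻¹≈ε
  fromℤ-neg (+ ℕ.suc n) = refl
  fromℤ-neg -[1+ n ]    = sym (⁻¹-involutive _)

  fromℤ-*-+ : ∀ m j → fromℤ (+ m ℤ.* j) ≡ (m mod p) ⊛ fromℤ j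
  fromℤ-*-+ m (+ n)     = trans (cong fromℤ (sym (ℤ.pos-* m n))) (mod-* m n)
  fromℤ-*-+ m -[1+ n ]  = begin
    fromℤ (+ m ℤ.* ℤ.- + ℕ.suc n)
      ≡⟨ cong fromℤ (ℤ.neg-distribʳ-* (+ m) (+ ℕ.suc n)) ⟨
    fromℤ (ℤ.- (+ m ℤ.* + ℕ.suc n))
      ≡⟨ fromℤ-neg (+ m ℤ.* + ℕ.suc n) ⟩
    ⊝ fromℤ (+ m ℤ.* + ℕ.suc n)
      ≡⟨ cong ⊝_ (fromℤ-*-+ m (+ ℕ.suc n)) ⟩
    ⊝ ((m mod p) ⊛ (ℕ.suc n mod p))
      ≡⟨ trans (cong ⊝_ (⊛-comm a b)) (trans (-‿distribˡ-* b a) (⊛-comm (⊝ b) a)) ⟩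
    (m mod p) ⊛ ⊝ (ℕ.suc n mod p) ∎
    where
    open ≡-Reasoning
    a b : Fₚ
    a = m mod p
    b = ℕ.suc n mod p

  fromℤ-* : ∀ i j → fromℤ (i ℤ.* j) ≡ fromℤ i ⊛ fromℤ j
  fromℤ-* (+ m)      j = fromℤ-*-+ m j
  fromℤ-* -[1+ m ]   j = begin
    fromℤ (ℤ.- + ℕ.suc m ℤ.* j)                   ≡⟨ cong fromℤ (ℤ.neg-distribˡ-* (+ ℕ.suc m) j) ⟨
    fromℤ (ℤ.- (+ ℕ.suc m ℤ.* j))                 ≡⟨ fromℤ-neg (+ ℕ.suc m ℤ.* j) ⟩
    ⊝ fromℤ (+ ℕ.suc m ℤ.* j)                     ≡⟨ cong ⊝_ (fromℤ-*-+ (ℕ.suc m) j) ⟩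
    ⊝ ((ℕ.suc m mod p) ⊛ fromℤ j)                 ≡⟨ -‿distribˡ-* (ℕ.suc m mod p) (fromℤ j) ⟩
    ⊝ (ℕ.suc m mod p) ⊛ fromℤ j                   ∎
    where open ≡-Reasoning

  fromℤ-morphism : CommutativeRing.rawRing ℤ.+-*-commutativeRing
                     ACR.-Raw-AlmostCommutative⟶ ACR.fromCommutativeRing +-*-commutativeRing
  fromℤ-morphism = record
    { ⟦_⟧ = fromℤ ; +-homo = fromℤ-+ ; *-homo = fromℤ-* ; -‿homo = fromℤ-neg ; 0-homo = refl ; 1-homo = refl }

  fromℤ-≟ : ∀ i j → Maybe (fromℤ i ≡ fromℤ j)
  fromℤ-≟ i j with i ℤ.≟ j
  ... | yes refl = just refl
  ... | no _     = nothing

  open Algebra.Solver.Ring _ (ACR.fromCommutativeRing +-*-commutativeRing) fromℤ-morphism fromℤ-≟ public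
    using (solve; _:+_; _:*_; :-_; _:=_)

  ⊖-interchange : ∀ x u y v → (x ⊖ u) ⊖ (y ⊖ v) ≡ (x ⊖ y) ⊖ (u ⊖ v)
  ⊖-interchange x u y v
    rewrite ⊖-as-⊕ (x ⊖ u) (y ⊖ v) | ⊖-as-⊕ (x ⊖ y) (u ⊖ v)
          | ⊖-as-⊕ x u | ⊖-as-⊕ y v | ⊖-as-⊕ x y | ⊖-as-⊕ u v
    = solve 4 (λ x u y v → (x :+ :- u) :+ :- (y :+ :- v) := (x :+ :- y) :+ :- (u :+ :- v)) refl x u y v

  ⊖-self : ∀ a → a ⊖ a ≡ 𝟘
  ⊖-self a = trans (⊖-as-⊕ a a) (⊕-inverseʳ a)

  ⊖≡𝟘⇔≡ : ∀ {a b} → (a ⊖ b ≡ 𝟘) ⇔ (a ≡ b)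
  ⊖≡𝟘⇔≡ {a} {b} = mk⇔ (λ e → x∙y⁻¹≈ε⇒x≈y a b (trans (sym (⊖-as-⊕ a b)) e)) (λ { refl → ⊖-self a })

  ≡⊕⇔⊖≡ : ∀ {x y e} → (x ≡ y ⊕ e) ⇔ (x ⊖ y ≡ e)
  ≡⊕⇔⊖≡ {x} {y} {e} = mk⇔
    (λ { refl → trans (⊖-as-⊕ (y ⊕ e) y) (solve 2 (λ y e → (y :+ e) :+ :- y := e) refl y e) })
    (λ { refl → sym (trans (cong (y ⊕_) (⊖-as-⊕ x y)) (solve 2 (λ x y → y :+ (x :+ :- y) := x) refl x y)) })

  ⊖≡⊖⇔⊖≡⊖ : ∀ {x u y v} → (x ⊖ u ≡ y ⊖ v) ⇔ (u ⊖ v ≡ x ⊖ y)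
  ⊖≡⊖⇔⊖≡⊖ {x} {u} {y} {v} = mk⇔ (λ e → sym (forth e)) (λ e → back (sym e))
    where
    forth : x ⊖ u ≡ y ⊖ v → x ⊖ y ≡ u ⊖ v
    forth e = Equivalence.to ⊖≡𝟘⇔≡
      (trans (sym (⊖-interchange x u y v)) (Equivalence.from ⊖≡𝟘⇔≡ e))
    back : x ⊖ y ≡ u ⊖ v → x ⊖ u ≡ y ⊖ v
    back e = Equivalence.to ⊖≡𝟘⇔≡
      (trans (⊖-interchange x u y v) (Equivalence.from ⊖≡𝟘⇔≡ e))

  ⊛-distribˡ-⊖ : ∀ a x y → a ⊛ (x ⊖ y) ≡ a ⊛ x ⊖ a ⊛ y
  ⊛-distribˡ-⊖ a x y rewrite ⊖-as-⊕ x y | ⊖-as-⊕ (a ⊛ x) (a ⊛ y)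
    = solve 3 (λ a x y → a :* (x :+ :- y) := a :* x :+ :- (a :* y)) refl a x y

  ⊖-⊕-interchange : ∀ a b c d → (a ⊖ b) ⊕ (c ⊖ d) ≡ (a ⊕ c) ⊖ (b ⊕ d)
  ⊖-⊕-interchange a b c d rewrite ⊖-as-⊕ a b | ⊖-as-⊕ c d | ⊖-as-⊕ (a ⊕ c) (b ⊕ d)
    = solve 4 (λ a b c d → (a :+ :- b) :+ (c :+ :- d) := (a :+ c) :+ :- (b :+ d)) refl a b c d

  ⊖-⊕-cancel : ∀ a b c d → (a ⊖ (b ⊕ c)) ⊖ (d ⊖ b) ≡ (a ⊖ d) ⊖ c
  ⊖-⊕-cancel a b c d rewrite ⊖-as-⊕ (a ⊖ (b ⊕ c)) (d ⊖ b) | ⊖-as-⊕ (a ⊖ d) c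
                           | ⊖-as-⊕ a (b ⊕ c) | ⊖-as-⊕ d b | ⊖-as-⊕ a d
    = solve 4 (λ a b c d → (a :+ :- (b :+ c)) :+ :- (d :+ :- b) := (a :+ :- d) :+ :- c) refl a b c d

  k*p-mod : ∀ k → (k ℕ.* p) mod p ≡ 𝟘
  k*p-mod k = Fin.toℕ-injective (trans (toℕ-mod _) (trans (m*n%n≡0 k p) (sym toℕ-𝟘)))

  ⊛-inverse : Prime p → ∀ a → a ≢ 𝟘 → ∃ λ s → s ⊛ a ≡ 𝟙
  ⊛-inverse p-prime a a≢𝟘 = fromBézout (coprime-Bézout (prime⇒coprime p-prime {{a≢0}} (Fin.toℕ<n a)))
    where
    open ≡-Reasoning
    a≢0 : NonZero (toℕ a)
    a≢0 = ℕ.≢-nonZero (λ e → a≢𝟘 (Fin.toℕ-injective (trans e (sym toℕ-𝟘))))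
    ya≡ : ∀ y → (y mod p) ⊛ a ≡ (y ℕ.* toℕ a) mod p
    ya≡ y = trans (cong ((y mod p) ⊛_) (sym (mod-toℕ a))) (sym (mod-* y (toℕ a)))
    fromBézout : Bézout.Identity 1 p (toℕ a) → ∃ λ s → s ⊛ a ≡ 𝟙
    fromBézout (Bézout.-+ x y eq) = y mod p , (begin
      (y mod p) ⊛ a                 ≡⟨ ya≡ y ⟩
      (y ℕ.* toℕ a) mod p           ≡⟨ cong (_mod p) eq ⟨
      (1 ℕ.+ x ℕ.* p) mod p         ≡⟨ mod-+ 1 (x ℕ.* p) ⟩
      𝟙 ⊕ ((x ℕ.* p) mod p)         ≡⟨ cong (𝟙 ⊕_) (k*p-mod x) ⟩
      𝟙 ⊕ 𝟘                         ≡⟨ ⊕-comm 𝟙 𝟘 ⟩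
      𝟘 ⊕ 𝟙                         ≡⟨ ⊕-identityˡ 𝟙 ⟩
      𝟙                             ∎)
    fromBézout (Bézout.+- x y eq) = ⊝ (y mod p) , (begin
      ⊝ (y mod p) ⊛ a               ≡⟨ -‿distribˡ-* (y mod p) a ⟨
      ⊝ ((y mod p) ⊛ a)             ≡⟨ cong ⊝_ (inverseʳ-unique 𝟙 ((y mod p) ⊛ a) 1+ya≡𝟘) ⟩
      ⊝ ⊝ 𝟙                         ≡⟨ ⁻¹-involutive 𝟙 ⟩
      𝟙                             ∎)
      where
      1+ya≡𝟘 : 𝟙 ⊕ (y mod p) ⊛ a ≡ 𝟘
      1+ya≡𝟘 = begin
        𝟙 ⊕ (y mod p) ⊛ a           ≡⟨ cong (𝟙 ⊕_) (ya≡ y) ⟩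
        𝟙 ⊕ ((y ℕ.* toℕ a) mod p)   ≡⟨ mod-+ 1 (y ℕ.* toℕ a) ⟨
        (1 ℕ.+ y ℕ.* toℕ a) mod p   ≡⟨ cong (_mod p) eq ⟩
        (x ℕ.* p) mod p             ≡⟨ k*p-mod x ⟩
        𝟘                           ∎

  ⊛-zeroˡ : ∀ a → 𝟘 ⊛ a ≡ 𝟘
  ⊛-zeroˡ = zeroˡ

  ⊛-zeroʳ : ∀ a → a ⊛ 𝟘 ≡ 𝟘
  ⊛-zeroʳ = zeroʳ

  ⊕≡⇔≡𝟘 : ∀ {b z} → (b ⊕ z ≡ b) ⇔ (z ≡ 𝟘)
  ⊕≡⇔≡𝟘 {b} {z} = mk⇔
    (λ e → sym (trans (sym (⊖-self b)) (Equivalence.to ≡⊕⇔⊖≡ (sym e))))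
    (λ { refl → trans (⊕-comm b 𝟘) (⊕-identityˡ b) })

∑-allFin-suc : ∀ m (h : Fin (ℕ.suc m) → ℤ) → ∑ (allFin (ℕ.suc m)) h ≡ h zero + ∑[ c ← allFin m ] h (suc c)
∑-allFin-suc m h = cong (_+_ (h zero)) (trans (cong (λ l → ∑ l h) (sym (List.map-tabulate id suc))) (∑-map suc (allFin m) h))

allFin-enumerates : ∀ m → Enumeration.Enumerates Fin._≟_ (allFin m)
allFin-enumerates (ℕ.suc m) zero    = trans (∑-allFin-suc m (λ c → ⟦ c Fin.≟ zero ⟧)) (cong (_+_ 1ℤ) (∑-zero (allFin m)))
allFin-enumerates (ℕ.suc m) (suc d) = trans (∑-allFin-suc m (λ c → ⟦ c Fin.≟ suc d ⟧))
                                              (trans (ℤ.+-identityˡ _) (allFin-enumerates m d))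

module VectorSpace (p : ℕ) .{{_ : NonZero p}} where

  open PrimeField p

  infixl 6 _⊞_ _⊟_
  infix  7 _·_
  infix  4 _≟ᵛ_

  _⊞_ _⊟_ : ∀ {n} → V p n → V p n → V p n
  _⊞_ = _+ᵥ_ p
  _⊟_ = _-ᵥ_ p

  𝟎 : ∀ {n} → V p n
  𝟎 = 0ᵥ p

  _·_ : ∀ {n} → V p n → V p n → Fₚ
  _·_ = ⟨_,_⟩ p

  _≟ᵛ_ : ∀ {n} → DecidableEquality (V p n)
  _≟ᵛ_ = _≟ᵥ_ p

  ⊞-identityʳ : ∀ {n} (x : V p n) → x ⊞ 𝟎 ≡ x
  ⊞-identityʳ []      = refl
  ⊞-identityʳ (a ∷ x) = cong₂ _∷_ (trans (⊕-comm a 𝟘) (⊕-identityˡ a)) (⊞-identityʳ x)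

  ≡⊞⇔⊟≡ : ∀ {n} {z y x : V p n} → (z ≡ y ⊞ x) ⇔ (z ⊟ y ≡ x)
  ≡⊞⇔⊟≡ {z = []}    {[]}    {[]}    = mk⇔ (λ _ → refl) (λ _ → refl)
  ≡⊞⇔⊟≡ {z = c ∷ z} {b ∷ y} {a ∷ x} = mk⇔
    (λ e → let (e₀ , e₁) = ∷-injective e in
           cong₂ _∷_ (Equivalence.to ≡⊕⇔⊖≡ e₀) (Equivalence.to ≡⊞⇔⊟≡ e₁))
    (λ e → let (e₀ , e₁) = ∷-injective e in
           cong₂ _∷_ (Equivalence.from ≡⊕⇔⊖≡ e₀) (Equivalence.from ≡⊞⇔⊟≡ e₁))

  ⊟≡𝟎⇔≡ : ∀ {n} {x y : V p n} → (x ⊟ y ≡ 𝟎) ⇔ (x ≡ y)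
  ⊟≡𝟎⇔≡ {x = x} {y} = mk⇔
    (λ e → trans (Equivalence.from ≡⊞⇔⊟≡ e) (⊞-identityʳ y))
    (λ e → Equivalence.to ≡⊞⇔⊟≡ (trans e (sym (⊞-identityʳ y))))

  ⊟-self : ∀ {n} (x : V p n) → x ⊟ x ≡ 𝟎
  ⊟-self x = Equivalence.from ⊟≡𝟎⇔≡ refl

  ·-⊞ˡ : ∀ {n} (c d x : V p n) → (c ⊞ d) · x ≡ c · x ⊕ d · x
  ·-⊞ˡ []      []      []      = sym (⊕-identityˡ 𝟘)
  ·-⊞ˡ (a ∷ c) (b ∷ d) (v ∷ x) = begin
    (a ⊕ b) ⊛ v ⊕ (c ⊞ d) · x             ≡⟨ cong₂ _⊕_ (trans (⊛-comm (a ⊕ b) v) (⊛-distribˡ-⊕ v a b)) (·-⊞ˡ c d x) ⟩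
    (v ⊛ a ⊕ v ⊛ b) ⊕ (c · x ⊕ d · x)     ≡⟨ cong₂ (λ s t → (s ⊕ t) ⊕ (c · x ⊕ d · x)) (⊛-comm v a) (⊛-comm v b) ⟩
    (a ⊛ v ⊕ b ⊛ v) ⊕ (c · x ⊕ d · x)     ≡⟨ ⊕-middleFour (a ⊛ v) (b ⊛ v) (c · x) (d · x) ⟩
    (a ⊛ v ⊕ c · x) ⊕ (b ⊛ v ⊕ d · x)     ∎
    where open ≡-Reasoning

  ·-⊞ʳ : ∀ {n} (c x y : V p n) → c · (x ⊞ y) ≡ c · x ⊕ c · y
  ·-⊞ʳ []      []      []      = sym (⊕-identityˡ 𝟘)
  ·-⊞ʳ (a ∷ c) (u ∷ x) (v ∷ y) = begin
    a ⊛ (u ⊕ v) ⊕ c · (x ⊞ y)             ≡⟨ cong₂ _⊕_ (⊛-distribˡ-⊕ a u v) (·-⊞ʳ c x y) ⟩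
    (a ⊛ u ⊕ a ⊛ v) ⊕ (c · x ⊕ c · y)     ≡⟨ ⊕-middleFour (a ⊛ u) (a ⊛ v) (c · x) (c · y) ⟩
    (a ⊛ u ⊕ c · x) ⊕ (a ⊛ v ⊕ c · y)     ∎
    where open ≡-Reasoning

  ·-⊟ʳ : ∀ {n} (c x y : V p n) → c · (x ⊟ y) ≡ c · x ⊖ c · y
  ·-⊟ʳ []      []      []      = sym (⊖-self 𝟘)
  ·-⊟ʳ (a ∷ c) (u ∷ x) (v ∷ y) = begin
    a ⊛ (u ⊖ v) ⊕ c · (x ⊟ y)             ≡⟨ cong₂ _⊕_ (⊛-distribˡ-⊖ a u v) (·-⊟ʳ c x y) ⟩
    (a ⊛ u ⊖ a ⊛ v) ⊕ (c · x ⊖ c · y)     ≡⟨ ⊖-⊕-interchange (a ⊛ u) (a ⊛ v) (c · x) (c · y) ⟩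
    (a ⊛ u ⊕ c · x) ⊖ (a ⊛ v ⊕ c · y)     ∎
    where open ≡-Reasoning

  ·-𝟎ˡ : ∀ {n} (x : V p n) → 𝟎 · x ≡ 𝟘
  ·-𝟎ˡ []      = refl
  ·-𝟎ˡ (v ∷ x) = trans (cong₂ _⊕_ (⊛-zeroˡ v) (·-𝟎ˡ x)) (⊕-identityˡ 𝟘)

  ·-𝟎ʳ : ∀ {n} (c : V p n) → c · 𝟎 ≡ 𝟘
  ·-𝟎ʳ []      = refl
  ·-𝟎ʳ (a ∷ c) = trans (cong₂ _⊕_ (⊛-zeroʳ a) (·-𝟎ʳ c)) (⊕-identityˡ 𝟘)

  ·-surjective : Prime p → ∀ {n} (A : V p n) → A ≢ 𝟎 → ∀ j → ∃ λ c → c · A ≡ j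
  ·-surjective p-prime []      A≢𝟎 j = contradiction refl A≢𝟎
  ·-surjective p-prime {ℕ.suc n} (v ∷ A) v∷A≢𝟎 j with A ≟ᵛ 𝟎
  ... | no A≢𝟎 = let (c , c·A≡j) = ·-surjective p-prime A A≢𝟎 j in
    𝟘 ∷ c , trans (cong₂ _⊕_ (⊛-zeroˡ v) c·A≡j) (⊕-identityˡ j)
  ... | yes refl = j ⊛ s ∷ 𝟎 , (begin
    j ⊛ s ⊛ v ⊕ 𝟎 {n} · 𝟎                   ≡⟨ cong (j ⊛ s ⊛ v ⊕_) (·-𝟎ˡ (𝟎 {n})) ⟩
    j ⊛ s ⊛ v ⊕ 𝟘                         ≡⟨ trans (⊕-comm _ 𝟘) (⊕-identityˡ _) ⟩
    j ⊛ s ⊛ v                             ≡⟨ ⊛-assoc j s v ⟩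
    j ⊛ (s ⊛ v)                           ≡⟨ cong (j ⊛_) s⊛v≡𝟙 ⟩
    j ⊛ 𝟙                                 ≡⟨ trans (⊛-comm j 𝟙) (⊛-identityˡ j) ⟩
    j                                     ∎)
    where
    open ≡-Reasoning
    v≢𝟘 : v ≢ 𝟘
    v≢𝟘 refl = v∷A≢𝟎 refl
    s : Fₚ
    s = proj₁ (⊛-inverse p-prime v v≢𝟘)
    s⊛v≡𝟙 : s ⊛ v ≡ 𝟙
    s⊛v≡𝟙 = proj₂ (⊛-inverse p-prime v v≢𝟘)

  Δ : ∀ {n} → (V p n → Fₚ) → V p n → V p n → Fₚ
  Δ g y a = g (y ⊞ a) ⊖ g y

  Δᵛ : ∀ {n} → (V p n → V p n) → V p n → V p n → V p n
  Δᵛ G y a = G (y ⊞ a) ⊟ G y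

  Δ-𝟎 : ∀ {n} (g : V p n → Fₚ) y → Δ g y 𝟎 ≡ 𝟘
  Δ-𝟎 g y = trans (cong (λ z → g z ⊖ g y) (⊞-identityʳ y)) (⊖-self (g y))

  Δᵛ-𝟎 : ∀ {n} (G : V p n → V p n) x → Δᵛ G x 𝟎 ≡ 𝟎
  Δᵛ-𝟎 G x = trans (cong (λ z → G z ⊟ G x) (⊞-identityʳ x)) (⊟-self (G x))

  Δ-component : ∀ {n} (G : V p n → V p n) u y a → Δ (component p G u) y a ≡ u · Δᵛ G y a
  Δ-component G u y a = sym (·-⊟ʳ u (G (y ⊞ a)) (G y))

module VectorSums (p : ℕ) .{{_ : NonZero p}} where

  open PrimeField p
  open VectorSpace p

  𝔽 : List Fₚ
  𝔽 = allFin p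

  𝕍 : ∀ n → List (V p n)
  𝕍 = allVecs p

  ∑-𝔽-const : ∀ k → ∑[ _ ← 𝔽 ] k ≡ + p * k
  ∑-𝔽-const k = trans (∑-const 𝔽 k) (cong (λ l → + l * k) (List.length-tabulate {n = p} id))

  ∑-𝔽-sift : ∀ d (h : Fₚ → ℤ) → ∑[ c ← 𝔽 ] (⟦ c ≟ₚ d ⟧ * h c) ≡ h d
  ∑-𝔽-sift = Enumeration.∑-sift _≟ₚ_ 𝔽 (allFin-enumerates p)

  ∑-𝕍-suc : ∀ n (h : V p (ℕ.suc n) → ℤ) → ∑ (𝕍 (ℕ.suc n)) h ≡ ∑[ c ← 𝔽 ] ∑[ x ← 𝕍 n ] h (c ∷ x)
  ∑-𝕍-suc n h = trans (∑-concatMap (λ c → map (c ∷_) (𝕍 n)) 𝔽 h) (∑-cong 𝔽 (λ c → ∑-map (c ∷_) (𝕍 n) h))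

  𝕍-enumerates : ∀ n → Enumeration.Enumerates _≟ᵛ_ (𝕍 n)
  𝕍-enumerates ℕ.zero    []      = refl
  𝕍-enumerates (ℕ.suc n) (d ∷ y) = begin
    ∑[ x ← 𝕍 (ℕ.suc n) ] ⟦ x ≟ᵛ d ∷ y ⟧
      ≡⟨ ∑-𝕍-suc n (λ x → ⟦ x ≟ᵛ d ∷ y ⟧) ⟩
    ∑[ c ← 𝔽 ] ∑[ x ← 𝕍 n ] ⟦ c ∷ x ≟ᵛ d ∷ y ⟧
      ≡⟨ ∑-cong 𝔽 (λ c → ∑-cong (𝕍 n) (λ x → sym (⟦⟧-× (c ≟ₚ d) (x ≟ᵛ y)))) ⟩
    ∑[ c ← 𝔽 ] ∑[ x ← 𝕍 n ] (⟦ c ≟ₚ d ⟧ * ⟦ x ≟ᵛ y ⟧)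
      ≡⟨ ∑-*-∑ 𝔽 (𝕍 n) (λ c → ⟦ c ≟ₚ d ⟧) (λ x → ⟦ x ≟ᵛ y ⟧) ⟨
    ∑[ c ← 𝔽 ] ⟦ c ≟ₚ d ⟧ * ∑[ x ← 𝕍 n ] ⟦ x ≟ᵛ y ⟧
      ≡⟨ cong₂ _*_ (allFin-enumerates p d) (𝕍-enumerates n y) ⟩
    1ℤ ∎
    where open ≡-Reasoning

  ∑-𝕍-sift : ∀ n y (h : V p n → ℤ) → ∑[ x ← 𝕍 n ] (⟦ x ≟ᵛ y ⟧ * h x) ≡ h y
  ∑-𝕍-sift n = Enumeration.∑-sift _≟ᵛ_ (𝕍 n) (𝕍-enumerates n)

  ∑-𝕍-const : ∀ n k → ∑[ _ ← 𝕍 n ] k ≡ + p ^ n * k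
  ∑-𝕍-const ℕ.zero    k = trans (ℤ.+-identityʳ k) (sym (ℤ.*-identityˡ k))
  ∑-𝕍-const (ℕ.suc n) k = begin
    ∑[ _ ← 𝕍 (ℕ.suc n) ] k              ≡⟨ ∑-𝕍-suc n (λ _ → k) ⟩
    ∑[ _ ← 𝔽 ] ∑[ _ ← 𝕍 n ] k           ≡⟨ ∑-cong 𝔽 (λ _ → ∑-𝕍-const n k) ⟩
    ∑[ _ ← 𝔽 ] (+ p ^ n * k)            ≡⟨ ∑-𝔽-const (+ p ^ n * k) ⟩
    + p * (+ p ^ n * k)                 ≡⟨ ℤ.*-assoc (+ p) (+ p ^ n) k ⟨
    + p * + p ^ n * k                   ≡⟨ cong (_* k) (ℤ.pos-* p (p ^ n)) ⟨
    + p ^ ℕ.suc n * k                   ∎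
    where open ≡-Reasoning

  ∑-𝕍-translate : ∀ n (y : V p n) (h : V p n → ℤ) → ∑[ a ← 𝕍 n ] h (y ⊞ a) ≡ ∑ (𝕍 n) h
  ∑-𝕍-translate n y = Enumeration.∑-reindex _≟ᵛ_ (𝕍 n) (𝕍-enumerates n) (y ⊞_) (_⊟ y)
    (λ a z → mk⇔ (λ e → sym (Equivalence.to ≡⊞⇔⊟≡ e)) (λ e → Equivalence.from ≡⊞⇔⊟≡ (sym e)))

  ∑-𝔽-⟦≟⟧ : ∀ d → ∑[ e ← 𝔽 ] ⟦ d ≟ₚ e ⟧ ≡ 1ℤ
  ∑-𝔽-⟦≟⟧ = Enumeration.∑-⟦≟⟧ʳ _≟ₚ_ 𝔽 (allFin-enumerates p)

  ∑-𝔽-⟦≟⟧*⟦≟⟧ : ∀ a b → ∑[ e ← 𝔽 ] (⟦ a ≟ₚ e ⟧ * ⟦ b ≟ₚ e ⟧) ≡ ⟦ a ≟ₚ b ⟧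
  ∑-𝔽-⟦≟⟧*⟦≟⟧ = Enumeration.∑-⟦≟⟧*⟦≟⟧ _≟ₚ_ 𝔽 (allFin-enumerates p)

  ∑-𝕍-⟦≟⟧ : ∀ n d → ∑[ x ← 𝕍 n ] ⟦ d ≟ᵛ x ⟧ ≡ 1ℤ
  ∑-𝕍-⟦≟⟧ n = Enumeration.∑-⟦≟⟧ʳ _≟ᵛ_ (𝕍 n) (𝕍-enumerates n)

  ∑-𝕍-⟦≟⟧*⟦≟⟧ : ∀ n a b → ∑[ x ← 𝕍 n ] (⟦ a ≟ᵛ x ⟧ * ⟦ b ≟ᵛ x ⟧) ≡ ⟦ a ≟ᵛ b ⟧
  ∑-𝕍-⟦≟⟧*⟦≟⟧ n = Enumeration.∑-⟦≟⟧*⟦≟⟧ _≟ᵛ_ (𝕍 n) (𝕍-enumerates n)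

  ∑-𝕍-split : ∀ n (h : V p n → ℤ) X → (∀ u → u ≢ 𝟎 → h u ≡ X) → ∑ (𝕍 n) h ≡ h 𝟎 + (+ p ^ n - 1ℤ) * X
  ∑-𝕍-split n h X h≡X = begin
    ∑ (𝕍 n) h
      ≡⟨ ∑-cong (𝕍 n) pointwise ⟩
    ∑[ u ← 𝕍 n ] (X + ⟦ u ≟ᵛ 𝟎 ⟧ * (h 𝟎 - X))
      ≡⟨ ∑-distrib-+ (𝕍 n) (λ _ → X) (λ u → ⟦ u ≟ᵛ 𝟎 ⟧ * (h 𝟎 - X)) ⟩
    ∑[ _ ← 𝕍 n ] X + ∑[ u ← 𝕍 n ] (⟦ u ≟ᵛ 𝟎 ⟧ * (h 𝟎 - X))
      ≡⟨ cong₂ _+_ (∑-𝕍-const n X) (∑-𝕍-sift n 𝟎 (λ _ → h 𝟎 - X)) ⟩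
    + p ^ n * X + (h 𝟎 - X)
      ≡⟨ rearrange (+ p ^ n) X (h 𝟎) ⟩
    h 𝟎 + (+ p ^ n - 1ℤ) * X ∎
    where
    open ≡-Reasoning
    pointwise : ∀ u → h u ≡ X + ⟦ u ≟ᵛ 𝟎 ⟧ * (h 𝟎 - X)
    pointwise u with u ≟ᵛ 𝟎
    ... | yes refl = sym (trans (cong (_+_ X) (ℤ.*-identityˡ (h 𝟎 - X))) (cancel X (h 𝟎)))
      where
      cancel : ∀ a b → a + (b - a) ≡ b
      cancel = solve-∀
    ... | no u≢𝟎  = trans (h≡X u u≢𝟎) (sym (ℤ.+-identityʳ X))
    rearrange : ∀ q X h₀ → q * X + (h₀ - X) ≡ h₀ + (q - 1ℤ) * X
    rearrange = solve-∀

  ∑-𝕍-without-𝟎 : ∀ n (g : V p n → ℤ) → ∑[ a ← 𝕍 n ] ((1ℤ - ⟦ a ≟ᵛ 𝟎 ⟧) * g a) ≡ ∑ (𝕍 n) g - g 𝟎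
  ∑-𝕍-without-𝟎 n g = begin
    ∑[ a ← 𝕍 n ] ((1ℤ - ⟦ a ≟ᵛ 𝟎 ⟧) * g a)          ≡⟨ ∑-cong (𝕍 n) (λ a → expand ⟦ a ≟ᵛ 𝟎 ⟧ (g a)) ⟩
    ∑[ a ← 𝕍 n ] (g a - ⟦ a ≟ᵛ 𝟎 ⟧ * g a)           ≡⟨ ∑-distrib-- (𝕍 n) g (λ a → ⟦ a ≟ᵛ 𝟎 ⟧ * g a) ⟩
    ∑ (𝕍 n) g - ∑[ a ← 𝕍 n ] (⟦ a ≟ᵛ 𝟎 ⟧ * g a)     ≡⟨ cong (_-_ (∑ (𝕍 n) g)) (∑-𝕍-sift n 𝟎 g) ⟩
    ∑ (𝕍 n) g - g 𝟎                                ∎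
    where
    open ≡-Reasoning
    expand : ∀ x y → (1ℤ - x) * y ≡ y - x * y
    expand = solve-∀

  ∈-𝕍 : ∀ {n} (y : V p n) → y ∈ 𝕍 n
  ∈-𝕍 {n} y = Enumeration.∑-⟦≟⟧≡1⇒∈ _≟ᵛ_ (𝕍 n) y (𝕍-enumerates n y)

  All-nonzero-rows⇔ : ∀ {n} (g : V p n → V p n → ℕ) {P : ℕ → Set} →
                      All P (concatMap (λ a → map (g a) (𝕍 n)) (nonzeroVecs p n)) ⇔ (∀ a b → a ≢ 𝟎 → P (g a b))
  All-nonzero-rows⇔ {n} g {P} = mk⇔
    (λ all a b a≢𝟎 → All.lookup (All.map⁻ (All.lookup (All.map⁻ (All.concat⁻ all))
                                                       (∈-filter⁺ nonzero? (∈-𝕍 a) a≢𝟎)))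
                                (∈-𝕍 b))
    (λ every → All.concat⁺ (All.map⁺ (All.tabulate (λ {a} a∈ →
       All.map⁺ (All.universal (λ b → every a b (proj₂ (∈-filter⁻ nonzero? {xs = 𝕍 n} a∈))) (𝕍 n))))))
    where
    nonzero? : ∀ a → Dec (a ≢ 𝟎)
    nonzero? a = ¬? (a ≟ᵛ 𝟎)

module Characters (p : ℕ) .{{_ : NonZero p}} where

  open PrimeField p
  open VectorSpace p
  open VectorSums p

  -- ψ x y = Σ_{k ∈ F_p^*} ζ^{k(x − y)}, an integer.
  ψ : Fₚ → Fₚ → ℤ
  ψ x y = + p * ⟦ x ≟ₚ y ⟧ - 1ℤ

  ψ-cong : ∀ {x y x′ y′} → (x ≡ y) ⇔ (x′ ≡ y′) → ψ x y ≡ ψ x′ y′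
  ψ-cong {x} {y} {x′} {y′} eq = cong (λ z → + p * z - 1ℤ) (⟦⟧-cong (x ≟ₚ y) (x′ ≟ₚ y′) eq)

  ψ-refl : ∀ x → ψ x x ≡ + p - 1ℤ
  ψ-refl x = trans (cong (λ z → + p * z - 1ℤ) (⟦⟧-yes (x ≟ₚ x) refl)) (cong (_- 1ℤ) (ℤ.*-identityʳ (+ p)))

  module _ (p-prime : Prime p) {n : ℕ} (A : V p n) (A≢𝟎 : A ≢ 𝟎) where

    private
      N : Fₚ → ℤ
      N β = ∑[ c ← 𝕍 n ] ⟦ c · A ≟ₚ β ⟧

      N-constant : ∀ β → N β ≡ N 𝟘
      N-constant β = let (c₀ , c₀·A≡β) = ·-surjective p-prime A A≢𝟎 β in begin
        ∑[ c ← 𝕍 n ] ⟦ c · A ≟ₚ β ⟧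
          ≡⟨ ∑-𝕍-translate n c₀ (λ c → ⟦ c · A ≟ₚ β ⟧) ⟨
        ∑[ c ← 𝕍 n ] ⟦ (c₀ ⊞ c) · A ≟ₚ β ⟧
          ≡⟨ ∑-cong (𝕍 n) (λ c → ⟦⟧-cong ((c₀ ⊞ c) · A ≟ₚ β) (c · A ≟ₚ 𝟘) (shifted c₀ c c₀·A≡β)) ⟩
        ∑[ c ← 𝕍 n ] ⟦ c · A ≟ₚ 𝟘 ⟧ ∎
        where
        open ≡-Reasoning
        shifted : ∀ c₀ c → c₀ · A ≡ β → ((c₀ ⊞ c) · A ≡ β) ⇔ (c · A ≡ 𝟘)
        shifted c₀ c refl = subst (λ z → (z ≡ c₀ · A) ⇔ (c · A ≡ 𝟘)) (sym (·-⊞ˡ c₀ c A)) ⊕≡⇔≡𝟘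

    count-·-≡ : ∀ β → + p * ∑[ c ← 𝕍 n ] ⟦ c · A ≟ₚ β ⟧ ≡ + p ^ n
    count-·-≡ β = begin
      + p * N β                                 ≡⟨ cong (_*_ (+ p)) (N-constant β) ⟩
      + p * N 𝟘                                 ≡⟨ ∑-𝔽-const (N 𝟘) ⟨
      ∑[ _ ← 𝔽 ] N 𝟘                            ≡⟨ ∑-cong 𝔽 (λ b → sym (N-constant b)) ⟩
      ∑[ b ← 𝔽 ] N b                            ≡⟨ ∑-comm 𝔽 (𝕍 n) (λ b c → ⟦ c · A ≟ₚ b ⟧) ⟩
      ∑[ c ← 𝕍 n ] ∑[ b ← 𝔽 ] ⟦ c · A ≟ₚ b ⟧    ≡⟨ ∑-cong (𝕍 n) (λ c → ∑-𝔽-⟦≟⟧ (c · A)) ⟩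
      ∑[ _ ← 𝕍 n ] 1ℤ                           ≡⟨ ∑-𝕍-const n 1ℤ ⟩
      + p ^ n * 1ℤ                              ≡⟨ ℤ.*-identityʳ (+ p ^ n) ⟩
      + p ^ n                                   ∎
      where open ≡-Reasoning

  ∑-ψ-· : Prime p → ∀ {n} (A : V p n) β → ∑[ c ← 𝕍 n ] ψ (c · A) β ≡ ⟦ A ≟ᵛ 𝟎 ⟧ * (+ p ^ n * ψ 𝟘 β)
  ∑-ψ-· p-prime {n} A β with A ≟ᵛ 𝟎
  ... | yes refl = begin
    ∑[ c ← 𝕍 n ] ψ (c · 𝟎) β                  ≡⟨ ∑-cong (𝕍 n) (λ c → cong (λ z → ψ z β) (·-𝟎ʳ c)) ⟩
    ∑[ _ ← 𝕍 n ] ψ 𝟘 β                        ≡⟨ ∑-𝕍-const n (ψ 𝟘 β) ⟩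
    + p ^ n * ψ 𝟘 β                           ≡⟨ ℤ.*-identityˡ (+ p ^ n * ψ 𝟘 β) ⟨
    1ℤ * (+ p ^ n * ψ 𝟘 β)                    ∎
    where open ≡-Reasoning
  ... | no A≢𝟎 = begin
    ∑[ c ← 𝕍 n ] (+ p * ⟦ c · A ≟ₚ β ⟧ - 1ℤ)
      ≡⟨ ∑-distrib-- (𝕍 n) (λ c → + p * ⟦ c · A ≟ₚ β ⟧) (λ _ → 1ℤ) ⟩
    ∑[ c ← 𝕍 n ] (+ p * ⟦ c · A ≟ₚ β ⟧) - ∑[ _ ← 𝕍 n ] 1ℤ
      ≡⟨ cong₂ _-_ (*-distribˡ-∑ (𝕍 n) (+ p) (λ c → ⟦ c · A ≟ₚ β ⟧)) (sym (∑-𝕍-const n 1ℤ)) ⟨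
    + p * ∑[ c ← 𝕍 n ] ⟦ c · A ≟ₚ β ⟧ - + p ^ n * 1ℤ
      ≡⟨ cong₂ _-_ (count-·-≡ p-prime A A≢𝟎 β) (ℤ.*-identityʳ (+ p ^ n)) ⟩
    + p ^ n - + p ^ n
      ≡⟨ ℤ.+-inverseʳ (+ p ^ n) ⟩
    0ℤ ∎
    where open ≡-Reasoning

module Moments (p : ℕ) .{{_ : NonZero p}} where

  open PrimeField p
  open VectorSpace p
  open VectorSums p
  open Characters p

  -- If R e is the coefficient of ζ^e in |w|², then M₂ R and M₄ R are the sums of |σ w|² and |σ w|⁴
  -- over the automorphisms σ : ζ ↦ ζ^k, k ≠ 0; they are integers, so no complex numbers are needed.
  M₂ M₄ : (Fₚ → ℤ) → ℤ
  M₂ R = + p * R 𝟘 - ∑ 𝔽 R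
  M₄ R = + p * ∑[ e ← 𝔽 ] (R e * R e) - ∑ 𝔽 R * ∑ 𝔽 R

  M₂-cong : ∀ {R R′ : Fₚ → ℤ} → (∀ e → R e ≡ R′ e) → M₂ R ≡ M₂ R′
  M₂-cong R≗R′ = cong₂ (λ a b → + p * a - b) (R≗R′ 𝟘) (∑-cong 𝔽 R≗R′)

  M₄-cong : ∀ {R R′ : Fₚ → ℤ} → (∀ e → R e ≡ R′ e) → M₄ R ≡ M₄ R′
  M₄-cong R≗R′ = cong₂ (λ a b → + p * a - b * b) (∑-cong 𝔽 (λ e → cong₂ _*_ (R≗R′ e) (R≗R′ e))) (∑-cong 𝔽 R≗R′)

  ∑-𝔽-point : ∀ a b → ∑[ e ← 𝔽 ] (a + b * ⟦ e ≟ₚ 𝟘 ⟧) ≡ + p * a + b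
  ∑-𝔽-point a b = begin
    ∑[ e ← 𝔽 ] (a + b * ⟦ e ≟ₚ 𝟘 ⟧)           ≡⟨ ∑-distrib-+ 𝔽 (λ _ → a) (λ e → b * ⟦ e ≟ₚ 𝟘 ⟧) ⟩
    ∑[ _ ← 𝔽 ] a + ∑[ e ← 𝔽 ] (b * ⟦ e ≟ₚ 𝟘 ⟧) ≡⟨ cong₂ _+_ (sym (∑-𝔽-const a)) (*-distribˡ-∑ 𝔽 b (λ e → ⟦ e ≟ₚ 𝟘 ⟧)) ⟨
    + p * a + b * ∑[ e ← 𝔽 ] ⟦ e ≟ₚ 𝟘 ⟧         ≡⟨ cong (λ z → + p * a + b * z) (allFin-enumerates p 𝟘) ⟩
    + p * a + b * 1ℤ                            ≡⟨ cong (_+_ (+ p * a)) (ℤ.*-identityʳ b) ⟩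
    + p * a + b                                 ∎
    where open ≡-Reasoning

  module PointMass (R : Fₚ → ℤ) (m s : ℤ) (R≡ : ∀ e → R e ≡ m + s * ⟦ e ≟ₚ 𝟘 ⟧) where

    ∑-R : ∑ 𝔽 R ≡ + p * m + s
    ∑-R = trans (∑-cong 𝔽 R≡) (∑-𝔽-point m s)

    ∑-R*R : ∑[ e ← 𝔽 ] (R e * R e) ≡ + p * (m * m) + (m * s + m * s + s * s)
    ∑-R*R = trans (∑-cong 𝔽 square) (∑-𝔽-point (m * m) (m * s + m * s + s * s))
      where
      open ≡-Reasoning
      square : ∀ e → R e * R e ≡ m * m + (m * s + m * s + s * s) * ⟦ e ≟ₚ 𝟘 ⟧
      square e = begin
        R e * R e
          ≡⟨ cong₂ _*_ (R≡ e) (R≡ e) ⟩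
        (m + s * x) * (m + s * x)
          ≡⟨ expand m s x ⟩
        m * m + (m * s + m * s) * x + s * s * (x * x)
          ≡⟨ cong (λ z → m * m + (m * s + m * s) * x + s * s * z) (⟦⟧-idem (e ≟ₚ 𝟘)) ⟩
        m * m + (m * s + m * s) * x + s * s * x
          ≡⟨ collect m s x ⟩
        m * m + (m * s + m * s + s * s) * x ∎
        where
        x : ℤ
        x = ⟦ e ≟ₚ 𝟘 ⟧
        expand : ∀ m s x → (m + s * x) * (m + s * x) ≡ m * m + (m * s + m * s) * x + s * s * (x * x)
        expand = solve-∀
        collect : ∀ m s x → m * m + (m * s + m * s) * x + s * s * x ≡ m * m + (m * s + m * s + s * s) * x
        collect = solve-∀

    M₂-R : M₂ R ≡ (+ p - 1ℤ) * s
    M₂-R = begin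
      + p * R 𝟘 - ∑ 𝔽 R                   ≡⟨ cong₂ (λ a b → + p * a - b) R𝟘 ∑-R ⟩
      + p * (m + s) - (+ p * m + s)       ≡⟨ simplify (+ p) m s ⟩
      (+ p - 1ℤ) * s                      ∎
      where
      open ≡-Reasoning
      R𝟘 : R 𝟘 ≡ m + s
      R𝟘 = trans (R≡ 𝟘) (trans (cong (λ z → m + s * z) (⟦⟧-yes (𝟘 ≟ₚ 𝟘) refl)) (cong (_+_ m) (ℤ.*-identityʳ s)))
      simplify : ∀ q m s → q * (m + s) - (q * m + s) ≡ (q - 1ℤ) * s
      simplify = solve-∀

    M₄-R : M₄ R ≡ (+ p - 1ℤ) * s * s
    M₄-R = begin
      + p * ∑[ e ← 𝔽 ] (R e * R e) - ∑ 𝔽 R * ∑ 𝔽 R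
        ≡⟨ cong₂ (λ a b → + p * a - b * b) ∑-R*R ∑-R ⟩
      + p * (+ p * (m * m) + (m * s + m * s + s * s)) - (+ p * m + s) * (+ p * m + s)
        ≡⟨ simplify (+ p) m s ⟩
      (+ p - 1ℤ) * s * s ∎
      where
      open ≡-Reasoning
      simplify : ∀ q m s → q * (q * (m * m) + (m * s + m * s + s * s)) - (q * m + s) * (q * m + s) ≡ (q - 1ℤ) * s * s
      simplify = solve-∀

  const-≡ : ∀ c k → const p c k ≡ c * ⟦ k ≟ₚ 𝟘 ⟧
  const-≡ c k with toℕ k in toℕk≡
  ... | ℕ.zero  = sym (trans (cong (c *_) (⟦⟧-yes (k ≟ₚ 𝟘) k≡𝟘)) (ℤ.*-identityʳ c))
    where k≡𝟘 = Fin.toℕ-injective (trans toℕk≡ (sym toℕ-𝟘))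
  ... | ℕ.suc _ = sym (trans (cong (c *_) (⟦⟧-no (k ≟ₚ 𝟘) k≢𝟘)) (ℤ.*-zeroʳ c))
    where
    k≢𝟘 : k ≢ 𝟘
    k≢𝟘 refl with () ← trans (sym toℕk≡) toℕ-𝟘

  plateau-moments : ∀ (w : Zζ p) P → _≈ζ_ p w (const p 0ℤ) ⊎ _≈ζ_ p (normSq p w) (const p P) →
                    M₄ (normSq p w) ≡ P * M₂ (normSq p w)
  plateau-moments w P (inj₁ (m , w-0≡m)) = begin
    M₄ R                            ≡⟨ PointMass.M₄-R R (+ p * (m * m)) 0ℤ R≡ ⟩
    (+ p - 1ℤ) * 0ℤ * 0ℤ            ≡⟨ vanish (+ p) P ⟩
    P * ((+ p - 1ℤ) * 0ℤ)           ≡⟨ cong (P *_) (PointMass.M₂-R R (+ p * (m * m)) 0ℤ R≡) ⟨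
    P * M₂ R                        ∎
    where
    open ≡-Reasoning
    R = normSq p w
    w≡m : ∀ k → w k ≡ m
    w≡m k = begin
      w k                           ≡⟨ ℤ.+-identityʳ (w k) ⟨
      w k - 0ℤ                      ≡⟨ cong (λ z → w k - z) (trans (const-≡ 0ℤ k) (ℤ.*-zeroˡ ⟦ k ≟ₚ 𝟘 ⟧)) ⟨
      w k - const p 0ℤ k            ≡⟨ w-0≡m k ⟩
      m                             ∎
    R≡ : ∀ e → R e ≡ + p * (m * m) + 0ℤ * ⟦ e ≟ₚ 𝟘 ⟧
    R≡ e = begin
      ∑[ k ← 𝔽 ] (w (k ⊕ e) * w k)  ≡⟨ ∑-cong 𝔽 (λ k → cong₂ _*_ (w≡m (k ⊕ e)) (w≡m k)) ⟩
      ∑[ _ ← 𝔽 ] (m * m)            ≡⟨ ∑-𝔽-const (m * m) ⟩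
      + p * (m * m)                 ≡⟨ ℤ.+-identityʳ _ ⟨
      + p * (m * m) + 0ℤ * ⟦ e ≟ₚ 𝟘 ⟧ ∎
    vanish : ∀ q P → (q - 1ℤ) * 0ℤ * 0ℤ ≡ P * ((q - 1ℤ) * 0ℤ)
    vanish = solve-∀
  plateau-moments w P (inj₂ (m , R-P≡m)) = begin
    M₄ R                            ≡⟨ PointMass.M₄-R R m P R≡ ⟩
    (+ p - 1ℤ) * P * P              ≡⟨ rearrange (+ p) P ⟩
    P * ((+ p - 1ℤ) * P)            ≡⟨ cong (P *_) (PointMass.M₂-R R m P R≡) ⟨
    P * M₂ R                        ∎
    where
    open ≡-Reasoning
    R = normSq p w
    R≡ : ∀ e → R e ≡ m + P * ⟦ e ≟ₚ 𝟘 ⟧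
    R≡ e = begin
      R e                           ≡⟨ split (R e) (const p P e) ⟩
      (R e - const p P e) + const p P e ≡⟨ cong₂ _+_ (R-P≡m e) (const-≡ P e) ⟩
      m + P * ⟦ e ≟ₚ 𝟘 ⟧            ∎
      where
      split : ∀ a b → a ≡ (a - b) + b
      split = solve-∀
    rearrange : ∀ q P → (q - 1ℤ) * P * P ≡ P * ((q - 1ℤ) * P)
    rearrange = solve-∀

  module PairCount {Y Z : Set} (ys : List Y) (zs : List Z) (D : Y → Z → Fₚ) where

    open DoubleSum ys zs

    R : Fₚ → ℤ
    R e = ∑₂ (λ y z → ⟦ D y z ≟ₚ e ⟧)

    ∑-R : ∑ 𝔽 R ≡ ∑₂ (λ _ _ → 1ℤ)
    ∑-R = trans (∑-∑₂-comm 𝔽 (λ e y z → ⟦ D y z ≟ₚ e ⟧)) (∑₂-cong (λ y z → ∑-𝔽-⟦≟⟧ (D y z)))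

    M₂-R : M₂ R ≡ ∑₂ (λ y z → ψ (D y z) 𝟘)
    M₂-R = trans (cong (λ s → + p * R 𝟘 - s) ∑-R) (∑₂-linear (+ p) (λ y z → ⟦ D y z ≟ₚ 𝟘 ⟧) (λ _ _ → 1ℤ))

    ∑-R*R : ∑[ e ← 𝔽 ] (R e * R e) ≡ ∑₂ (λ y z → ∑₂ (λ y′ z′ → ⟦ D y z ≟ₚ D y′ z′ ⟧))
    ∑-R*R = begin
      ∑[ e ← 𝔽 ] (R e * R e)
        ≡⟨ ∑-cong 𝔽 (λ e → ∑₂-*-∑₂ (X e) (X e)) ⟩
      ∑[ e ← 𝔽 ] ∑₂ (λ y z → ∑₂ (λ y′ z′ → X e y z * X e y′ z′))
        ≡⟨ ∑-∑₂-comm 𝔽 (λ e y z → ∑₂ (λ y′ z′ → X e y z * X e y′ z′)) ⟩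
      ∑₂ (λ y z → ∑[ e ← 𝔽 ] ∑₂ (λ y′ z′ → X e y z * X e y′ z′))
        ≡⟨ ∑₂-cong (λ y z → ∑-∑₂-comm 𝔽 (λ e y′ z′ → X e y z * X e y′ z′)) ⟩
      ∑₂ (λ y z → ∑₂ (λ y′ z′ → ∑[ e ← 𝔽 ] (X e y z * X e y′ z′)))
        ≡⟨ ∑₂-cong (λ y z → ∑₂-cong (λ y′ z′ → ∑-𝔽-⟦≟⟧*⟦≟⟧ (D y z) (D y′ z′))) ⟩
      ∑₂ (λ y z → ∑₂ (λ y′ z′ → ⟦ D y z ≟ₚ D y′ z′ ⟧)) ∎
      where
      open ≡-Reasoning
      X : Fₚ → Y → Z → ℤ
      X e y z = ⟦ D y z ≟ₚ e ⟧

    M₄-R : M₄ R ≡ ∑₂ (λ y z → ∑₂ (λ y′ z′ → ψ (D y z) (D y′ z′)))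
    M₄-R = begin
      + p * ∑[ e ← 𝔽 ] (R e * R e) - ∑ 𝔽 R * ∑ 𝔽 R
        ≡⟨ cong₂ (λ s t → + p * s - t * t) ∑-R*R ∑-R ⟩
      + p * ∑₂ (λ y z → ∑₂ (C y z)) - ∑₂ one * ∑₂ one
        ≡⟨ cong (_-_ (+ p * ∑₂ (λ y z → ∑₂ (C y z)))) (∑₂-*-∑₂ one one) ⟩
      + p * ∑₂ (λ y z → ∑₂ (C y z)) - ∑₂ (λ _ _ → ∑₂ one)
        ≡⟨ ∑₂-linear (+ p) (λ y z → ∑₂ (C y z)) (λ _ _ → ∑₂ one) ⟩
      ∑₂ (λ y z → + p * ∑₂ (C y z) - ∑₂ one)
        ≡⟨ ∑₂-cong (λ y z → ∑₂-linear (+ p) (C y z) one) ⟩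
      ∑₂ (λ y z → ∑₂ (λ y′ z′ → ψ (D y z) (D y′ z′))) ∎
      where
      open ≡-Reasoning
      C : Y → Z → Y → Z → ℤ
      C y z y′ z′ = ⟦ D y z ≟ₚ D y′ z′ ⟧
      one : Y → Z → ℤ
      one _ _ = 1ℤ

module WalshSpectrum (p : ℕ) .{{_ : NonZero p}} {n : ℕ} (f : V p n → Fp p) where

  open PrimeField p
  open VectorSpace p
  open VectorSums p
  open Characters p
  open Moments p
  open DoubleSum (𝕍 n) (𝕍 n)

  exponent : V p n → V p n → Fₚ
  exponent c x = f x ⊖ c · x

  Δ-exponent : ∀ c y a → Δ (exponent c) y a ≡ Δ f y a ⊖ c · a
  Δ-exponent c y a = begin
    (f (y ⊞ a) ⊖ c · (y ⊞ a)) ⊖ (f y ⊖ c · y)       ≡⟨ cong (λ z → (f (y ⊞ a) ⊖ z) ⊖ (f y ⊖ c · y)) (·-⊞ʳ c y a) ⟩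
    (f (y ⊞ a) ⊖ (c · y ⊕ c · a)) ⊖ (f y ⊖ c · y)   ≡⟨ ⊖-⊕-cancel (f (y ⊞ a)) (c · y) (c · a) (f y) ⟩
    Δ f y a ⊖ c · a                                 ∎
    where open ≡-Reasoning

  Walsh-count : ∀ c k → Walsh p f c k ≡ ∑[ x ← 𝕍 n ] ⟦ exponent c x ≟ₚ k ⟧
  Walsh-count c k = length-filter (λ x → exponent c x ≟ₚ k) (𝕍 n)

  normSq-Walsh : ∀ c e → normSq p (Walsh p f c) e ≡ PairCount.R (𝕍 n) (𝕍 n) (Δ (exponent c)) e
  normSq-Walsh c e = begin
    ∑[ k ← 𝔽 ] (W (k ⊕ e) * W k)
      ≡⟨ ∑-cong 𝔽 (λ k → cong₂ _*_ (Walsh-count c (k ⊕ e)) (Walsh-count c k)) ⟩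
    ∑[ k ← 𝔽 ] (S (k ⊕ e) * ∑[ y ← 𝕍 n ] ⟦ g y ≟ₚ k ⟧)
      ≡⟨ ∑-cong 𝔽 (λ k → trans (ℤ.*-comm (S (k ⊕ e)) _) (*-distribʳ-∑ (𝕍 n) (S (k ⊕ e)) (λ y → ⟦ g y ≟ₚ k ⟧))) ⟩
    ∑[ k ← 𝔽 ] ∑[ y ← 𝕍 n ] (⟦ g y ≟ₚ k ⟧ * S (k ⊕ e))
      ≡⟨ ∑-comm 𝔽 (𝕍 n) (λ k y → ⟦ g y ≟ₚ k ⟧ * S (k ⊕ e)) ⟩
    ∑[ y ← 𝕍 n ] ∑[ k ← 𝔽 ] (⟦ g y ≟ₚ k ⟧ * S (k ⊕ e))
      ≡⟨ ∑-cong (𝕍 n) (λ y → trans (∑-cong 𝔽 (λ k → cong (_* S (k ⊕ e)) (⟦⟧-cong (g y ≟ₚ k) (k ≟ₚ g y) (mk⇔ sym sym))))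
          (∑-𝔽-sift (g y) (λ k → S (k ⊕ e)))) ⟩
    ∑[ y ← 𝕍 n ] ∑[ x ← 𝕍 n ] ⟦ g x ≟ₚ g y ⊕ e ⟧
      ≡⟨ ∑-cong (𝕍 n) (λ y → ∑-𝕍-translate n y (λ x → ⟦ g x ≟ₚ g y ⊕ e ⟧)) ⟨
    ∑[ y ← 𝕍 n ] ∑[ a ← 𝕍 n ] ⟦ g (y ⊞ a) ≟ₚ g y ⊕ e ⟧
      ≡⟨ ∑₂-cong (λ y a → ⟦⟧-cong (g (y ⊞ a) ≟ₚ g y ⊕ e) (Δ g y a ≟ₚ e) ≡⊕⇔⊖≡) ⟩
    ∑[ y ← 𝕍 n ] ∑[ a ← 𝕍 n ] ⟦ Δ g y a ≟ₚ e ⟧ ∎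
    where
    open ≡-Reasoning
    W : Zζ p
    W = Walsh p f c
    g : V p n → Fₚ
    g = exponent c
    S : Fₚ → ℤ
    S k = ∑[ x ← 𝕍 n ] ⟦ g x ≟ₚ k ⟧

  M₂-Walsh : ∀ c → M₂ (normSq p (Walsh p f c)) ≡ ∑₂ (λ y a → ψ (c · a) (Δ f y a))
  M₂-Walsh c = begin
    M₂ (normSq p (Walsh p f c))                     ≡⟨ M₂-cong (normSq-Walsh c) ⟩
    M₂ (PairCount.R (𝕍 n) (𝕍 n) (Δ (exponent c)))   ≡⟨ PairCount.M₂-R (𝕍 n) (𝕍 n) (Δ (exponent c)) ⟩
    ∑₂ (λ y a → ψ (Δ (exponent c) y a) 𝟘)           ≡⟨ ∑₂-cong (λ y a → ψ-cong (vanishes y a)) ⟩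
    ∑₂ (λ y a → ψ (c · a) (Δ f y a))                ∎
    where
    open ≡-Reasoning
    vanishes : ∀ y a → (Δ (exponent c) y a ≡ 𝟘) ⇔ (c · a ≡ Δ f y a)
    vanishes y a = subst (λ z → (z ≡ 𝟘) ⇔ (c · a ≡ Δ f y a)) (sym (Δ-exponent c y a))
                         (mk⇔ (λ e → sym (Equivalence.to (⊖≡𝟘⇔≡ {Δ f y a} {c · a}) e))
                              (λ e → Equivalence.from (⊖≡𝟘⇔≡ {Δ f y a} {c · a}) (sym e)))

  M₄-Walsh : ∀ c → M₄ (normSq p (Walsh p f c)) ≡
             ∑₂ (λ y a → ∑₂ (λ y′ a′ → ψ (c · (a ⊟ a′)) (Δ f y a ⊖ Δ f y′ a′)))
  M₄-Walsh c = begin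
    M₄ (normSq p (Walsh p f c))
      ≡⟨ M₄-cong (normSq-Walsh c) ⟩
    M₄ (PairCount.R (𝕍 n) (𝕍 n) (Δ (exponent c)))
      ≡⟨ PairCount.M₄-R (𝕍 n) (𝕍 n) (Δ (exponent c)) ⟩
    ∑₂ (λ y a → ∑₂ (λ y′ a′ → ψ (Δ (exponent c) y a) (Δ (exponent c) y′ a′)))
      ≡⟨ ∑₂-cong (λ y a → ∑₂-cong (λ y′ a′ → ψ-cong (coincide y a y′ a′))) ⟩
    ∑₂ (λ y a → ∑₂ (λ y′ a′ → ψ (c · (a ⊟ a′)) (Δ f y a ⊖ Δ f y′ a′))) ∎
    where
    open ≡-Reasoning
    coincide : ∀ y a y′ a′ → (Δ (exponent c) y a ≡ Δ (exponent c) y′ a′) ⇔ (c · (a ⊟ a′) ≡ Δ f y a ⊖ Δ f y′ a′)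
    coincide y a y′ a′ rewrite Δ-exponent c y a | Δ-exponent c y′ a′ | ·-⊟ʳ c a a′
      = ⊖≡⊖⇔⊖≡⊖ {Δ f y a} {c · a} {Δ f y′ a′} {c · a′}

  module _ (p-prime : Prime p) where

    ∑-M₂-Walsh : ∑[ c ← 𝕍 n ] M₂ (normSq p (Walsh p f c)) ≡ + p ^ n * (+ p ^ n * (+ p - 1ℤ))
    ∑-M₂-Walsh = begin
      ∑[ c ← 𝕍 n ] M₂ (normSq p (Walsh p f c))
        ≡⟨ ∑-cong (𝕍 n) M₂-Walsh ⟩
      ∑[ c ← 𝕍 n ] ∑₂ (λ y a → ψ (c · a) (Δ f y a))
        ≡⟨ ∑-∑₂-comm (𝕍 n) (λ c y a → ψ (c · a) (Δ f y a)) ⟩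
      ∑₂ (λ y a → ∑[ c ← 𝕍 n ] ψ (c · a) (Δ f y a))
        ≡⟨ ∑₂-cong (λ y a → ∑-ψ-· p-prime a (Δ f y a)) ⟩
      ∑₂ (λ y a → ⟦ a ≟ᵛ 𝟎 ⟧ * (+ p ^ n * ψ 𝟘 (Δ f y a)))
        ≡⟨ ∑-cong (𝕍 n) (λ y → ∑-𝕍-sift n 𝟎 (λ a → + p ^ n * ψ 𝟘 (Δ f y a))) ⟩
      ∑[ y ← 𝕍 n ] (+ p ^ n * ψ 𝟘 (Δ f y 𝟎))
        ≡⟨ ∑-cong (𝕍 n) (λ y → cong (λ z → + p ^ n * ψ 𝟘 z) (Δ-𝟎 f y)) ⟩
      ∑[ y ← 𝕍 n ] (+ p ^ n * ψ 𝟘 𝟘)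
        ≡⟨ ∑-𝕍-const n (+ p ^ n * ψ 𝟘 𝟘) ⟩
      + p ^ n * (+ p ^ n * ψ 𝟘 𝟘)
        ≡⟨ cong (λ z → + p ^ n * (+ p ^ n * z)) (ψ-refl 𝟘) ⟩
      + p ^ n * (+ p ^ n * (+ p - 1ℤ)) ∎
      where open ≡-Reasoning

    ∑-M₄-Walsh : ∑[ c ← 𝕍 n ] M₄ (normSq p (Walsh p f c)) ≡
                 + p ^ n * ∑₂ (λ y a → ∑[ y′ ← 𝕍 n ] ψ 𝟘 (Δ f y a ⊖ Δ f y′ a))
    ∑-M₄-Walsh = begin
      ∑[ c ← 𝕍 n ] M₄ (normSq p (Walsh p f c))
        ≡⟨ ∑-cong (𝕍 n) M₄-Walsh ⟩
      ∑[ c ← 𝕍 n ] ∑₂ (λ y a → ∑₂ (λ y′ a′ → ψ (c · (a ⊟ a′)) (X y a y′ a′)))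
        ≡⟨ ∑-∑₂-comm (𝕍 n) (λ c y a → ∑₂ (λ y′ a′ → ψ (c · (a ⊟ a′)) (X y a y′ a′))) ⟩
      ∑₂ (λ y a → ∑[ c ← 𝕍 n ] ∑₂ (λ y′ a′ → ψ (c · (a ⊟ a′)) (X y a y′ a′)))
        ≡⟨ ∑₂-cong (λ y a → ∑-∑₂-comm (𝕍 n) (λ c y′ a′ → ψ (c · (a ⊟ a′)) (X y a y′ a′))) ⟩
      ∑₂ (λ y a → ∑₂ (λ y′ a′ → ∑[ c ← 𝕍 n ] ψ (c · (a ⊟ a′)) (X y a y′ a′)))
        ≡⟨ ∑₂-cong (λ y a → ∑₂-cong (λ y′ a′ → ∑-ψ-· p-prime (a ⊟ a′) (X y a y′ a′))) ⟩
      ∑₂ (λ y a → ∑₂ (λ y′ a′ → ⟦ a ⊟ a′ ≟ᵛ 𝟎 ⟧ * (+ p ^ n * ψ 𝟘 (X y a y′ a′))))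
        ≡⟨ ∑₂-cong (λ y a → ∑₂-cong (λ y′ a′ → cong (_* (+ p ^ n * ψ 𝟘 (X y a y′ a′)))
            (⟦⟧-cong (a ⊟ a′ ≟ᵛ 𝟎) (a′ ≟ᵛ a) (mk⇔ (λ e → sym (Equivalence.to ⊟≡𝟎⇔≡ e))
                                                  (λ e → Equivalence.from ⊟≡𝟎⇔≡ (sym e)))))) ⟩
      ∑₂ (λ y a → ∑₂ (λ y′ a′ → ⟦ a′ ≟ᵛ a ⟧ * (+ p ^ n * ψ 𝟘 (X y a y′ a′))))
        ≡⟨ ∑₂-cong (λ y a → ∑-cong (𝕍 n) (λ y′ → ∑-𝕍-sift n a (λ a′ → + p ^ n * ψ 𝟘 (X y a y′ a′)))) ⟩
      ∑₂ (λ y a → ∑[ y′ ← 𝕍 n ] (+ p ^ n * ψ 𝟘 (X y a y′ a)))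
        ≡⟨ ∑₂-cong (λ y a → *-distribˡ-∑ (𝕍 n) (+ p ^ n) (λ y′ → ψ 𝟘 (X y a y′ a))) ⟨
      ∑₂ (λ y a → + p ^ n * ∑[ y′ ← 𝕍 n ] ψ 𝟘 (X y a y′ a))
        ≡⟨ *-distribˡ-∑₂ (+ p ^ n) (λ y a → ∑[ y′ ← 𝕍 n ] ψ 𝟘 (X y a y′ a)) ⟨
      + p ^ n * ∑₂ (λ y a → ∑[ y′ ← 𝕍 n ] ψ 𝟘 (X y a y′ a)) ∎
      where
      open ≡-Reasoning
      X : V p n → V p n → V p n → V p n → Fₚ
      X y a y′ a′ = Δ f y a ⊖ Δ f y′ a′

module Coincidences (p : ℕ) .{{_ : NonZero p}} (p-prime : Prime p) {n : ℕ} (t : ℕ)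
                    (F : V p n → V p n) (F-plateaued : IsPlateaued p n t F) where

  open PrimeField p
  open VectorSpace p
  open VectorSums p
  open Characters p
  open Moments p
  open DoubleSum (𝕍 n) (𝕍 n)

  q Pₙ P : ℤ
  q  = + p
  Pₙ = + p ^ n
  P  = + p ^ (n ℕ.+ t)

  Q : ℤ
  Q = ∑₂ (λ y a → ∑[ y′ ← 𝕍 n ] ⟦ Δᵛ F y a ⊟ Δᵛ F y′ a ≟ᵛ 𝟎 ⟧)

  -- For u ≠ 𝟎, p^n · E u is the summed M₄ of the Walsh spectrum of ⟨u, F⟩ (E-plateaued), while
  -- orthogonality turns the sum of E over all u into a multiple of Q (∑-E).
  E : V p n → ℤ
  E u = ∑₂ (λ y a → ∑[ y′ ← 𝕍 n ] ψ (u · (Δᵛ F y a ⊟ Δᵛ F y′ a)) 𝟘)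

  E-plateaued : ∀ u → u ≢ 𝟎 → E u ≡ P * (Pₙ * (q - 1ℤ))
  E-plateaued u u≢𝟎 = ℤ.*-cancelˡ-≡ Pₙ (E u) (P * (Pₙ * (q - 1ℤ))) {{ℕ.m^n≢0 p n}} (begin
    Pₙ * E u
      ≡⟨ cong (Pₙ *_) (∑₂-cong (λ y a → ∑-cong (𝕍 n) (λ y′ → ψ-cong (coincidence⇔ y a y′)))) ⟩
    Pₙ * ∑₂ (λ y a → ∑[ y′ ← 𝕍 n ] ψ 𝟘 (Δ f y a ⊖ Δ f y′ a))
      ≡⟨ WS.∑-M₄-Walsh p-prime ⟨
    ∑[ c ← 𝕍 n ] M₄ (normSq p (Walsh p f c))
      ≡⟨ ∑-cong (𝕍 n) (λ c → plateau-moments (Walsh p f c) P (F-plateaued u u≢𝟎 c)) ⟩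
    ∑[ c ← 𝕍 n ] (P * M₂ (normSq p (Walsh p f c)))
      ≡⟨ *-distribˡ-∑ (𝕍 n) P (λ c → M₂ (normSq p (Walsh p f c))) ⟨
    P * ∑[ c ← 𝕍 n ] M₂ (normSq p (Walsh p f c))
      ≡⟨ cong (P *_) (WS.∑-M₂-Walsh p-prime) ⟩
    P * (Pₙ * (Pₙ * (q - 1ℤ)))
      ≡⟨ reorder P Pₙ q ⟩
    Pₙ * (P * (Pₙ * (q - 1ℤ))) ∎)
    where
    open ≡-Reasoning
    f : V p n → Fₚ
    f = component p F u
    module WS = WalshSpectrum p f
    coincidence⇔ : ∀ y a y′ → (u · (Δᵛ F y a ⊟ Δᵛ F y′ a) ≡ 𝟘) ⇔ (𝟘 ≡ Δ f y a ⊖ Δ f y′ a)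
    coincidence⇔ y a y′ rewrite Δ-component F u y a | Δ-component F u y′ a | ·-⊟ʳ u (Δᵛ F y a) (Δᵛ F y′ a) = mk⇔ sym sym
    reorder : ∀ P Pₙ q → P * (Pₙ * (Pₙ * (q - 1ℤ))) ≡ Pₙ * (P * (Pₙ * (q - 1ℤ)))
    reorder = solve-∀

  E-𝟎 : E 𝟎 ≡ Pₙ * (Pₙ * (Pₙ * (q - 1ℤ)))
  E-𝟎 = begin
    E 𝟎
      ≡⟨ ∑₂-cong (λ y a → ∑-cong (𝕍 n) (λ y′ → cong (λ z → ψ z 𝟘) (·-𝟎ˡ (Δᵛ F y a ⊟ Δᵛ F y′ a)))) ⟩
    ∑₂ (λ y a → ∑[ y′ ← 𝕍 n ] ψ 𝟘 𝟘)
      ≡⟨ ∑₂-cong (λ y a → ∑-𝕍-const n (ψ 𝟘 𝟘)) ⟩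
    ∑₂ (λ y a → Pₙ * ψ 𝟘 𝟘)
      ≡⟨ ∑-cong (𝕍 n) (λ y → ∑-𝕍-const n (Pₙ * ψ 𝟘 𝟘)) ⟩
    ∑[ y ← 𝕍 n ] (Pₙ * (Pₙ * ψ 𝟘 𝟘))
      ≡⟨ ∑-𝕍-const n (Pₙ * (Pₙ * ψ 𝟘 𝟘)) ⟩
    Pₙ * (Pₙ * (Pₙ * ψ 𝟘 𝟘))
      ≡⟨ cong (λ z → Pₙ * (Pₙ * (Pₙ * z))) (ψ-refl 𝟘) ⟩
    Pₙ * (Pₙ * (Pₙ * (q - 1ℤ))) ∎
    where open ≡-Reasoning

  ∑-E : ∑ (𝕍 n) E ≡ Pₙ * (q - 1ℤ) * Q
  ∑-E = begin
    ∑[ u ← 𝕍 n ] ∑₂ (λ y a → ∑[ y′ ← 𝕍 n ] ψ (u · D y a y′) 𝟘)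
      ≡⟨ ∑-∑₂-comm (𝕍 n) (λ u y a → ∑[ y′ ← 𝕍 n ] ψ (u · D y a y′) 𝟘) ⟩
    ∑₂ (λ y a → ∑[ u ← 𝕍 n ] ∑[ y′ ← 𝕍 n ] ψ (u · D y a y′) 𝟘)
      ≡⟨ ∑₂-cong (λ y a → ∑-comm (𝕍 n) (𝕍 n) (λ u y′ → ψ (u · D y a y′) 𝟘)) ⟩
    ∑₂ (λ y a → ∑[ y′ ← 𝕍 n ] ∑[ u ← 𝕍 n ] ψ (u · D y a y′) 𝟘)
      ≡⟨ ∑₂-cong (λ y a → ∑-cong (𝕍 n) (λ y′ → ∑-ψ-· p-prime (D y a y′) 𝟘)) ⟩
    ∑₂ (λ y a → ∑[ y′ ← 𝕍 n ] (⟦ D y a y′ ≟ᵛ 𝟎 ⟧ * (Pₙ * ψ 𝟘 𝟘)))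
      ≡⟨ ∑₂-cong (λ y a → ∑-cong (𝕍 n) (λ y′ →
          trans (ℤ.*-comm ⟦ D y a y′ ≟ᵛ 𝟎 ⟧ _) (cong (λ z → Pₙ * z * ⟦ D y a y′ ≟ᵛ 𝟎 ⟧) (ψ-refl 𝟘)))) ⟩
    ∑₂ (λ y a → ∑[ y′ ← 𝕍 n ] (c * ⟦ D y a y′ ≟ᵛ 𝟎 ⟧))
      ≡⟨ ∑₂-cong (λ y a → *-distribˡ-∑ (𝕍 n) c (λ y′ → ⟦ D y a y′ ≟ᵛ 𝟎 ⟧)) ⟨
    ∑₂ (λ y a → c * ∑[ y′ ← 𝕍 n ] ⟦ D y a y′ ≟ᵛ 𝟎 ⟧)
      ≡⟨ *-distribˡ-∑₂ c (λ y a → ∑[ y′ ← 𝕍 n ] ⟦ D y a y′ ≟ᵛ 𝟎 ⟧) ⟨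
    c * Q ∎
    where
    open ≡-Reasoning
    c : ℤ
    c = Pₙ * (q - 1ℤ)
    D : V p n → V p n → V p n → V p n
    D y a y′ = Δᵛ F y a ⊟ Δᵛ F y′ a

  Q-value : Q ≡ Pₙ * Pₙ + (Pₙ - 1ℤ) * P
  Q-value = ℤ.*-cancelˡ-≡ (Pₙ * (q - 1ℤ)) Q (Pₙ * Pₙ + (Pₙ - 1ℤ) * P) {{c≢0}} (begin
    Pₙ * (q - 1ℤ) * Q                                              ≡⟨ ∑-E ⟨
    ∑ (𝕍 n) E                                                      ≡⟨ ∑-𝕍-split n E (P * (Pₙ * (q - 1ℤ))) E-plateaued ⟩
    E 𝟎 + (Pₙ - 1ℤ) * (P * (Pₙ * (q - 1ℤ)))                        ≡⟨ cong (_+ (Pₙ - 1ℤ) * (P * (Pₙ * (q - 1ℤ)))) E-𝟎 ⟩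
    Pₙ * (Pₙ * (Pₙ * (q - 1ℤ))) + (Pₙ - 1ℤ) * (P * (Pₙ * (q - 1ℤ))) ≡⟨ factor Pₙ q P ⟩
    Pₙ * (q - 1ℤ) * (Pₙ * Pₙ + (Pₙ - 1ℤ) * P)                      ∎)
    where
    open ≡-Reasoning
    factor : ∀ Pₙ q P → Pₙ * (Pₙ * (Pₙ * (q - 1ℤ))) + (Pₙ - 1ℤ) * (P * (Pₙ * (q - 1ℤ))) ≡ Pₙ * (q - 1ℤ) * (Pₙ * Pₙ + (Pₙ - 1ℤ) * P)
    factor = solve-∀
    q-1≢0 : ∀ m → 1 ℕ.< m → ℤ.NonZero (+ m - 1ℤ)
    q-1≢0 (ℕ.suc (ℕ.suc _)) _           = _
    q-1≢0 (ℕ.suc ℕ.zero)    (ℕ.s≤s ())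
    c≢0 : ℤ.NonZero (Pₙ * (q - 1ℤ))
    c≢0 = ℤ.i*j≢0 Pₙ (q - 1ℤ) {{ℕ.m^n≢0 p n}} {{q-1≢0 p (ℕ.nonTrivial⇒n>1 p {{prime⇒nonTrivial p-prime}})}}

  N : V p n → V p n → ℤ
  N a b = + diffCount p F a b

  N-count : ∀ a b → N a b ≡ ∑[ x ← 𝕍 n ] ⟦ Δᵛ F x a ≟ᵛ b ⟧
  N-count a b = length-filter (λ x → Δᵛ F x a ≟ᵛ b) (𝕍 n)

  ∑-N : ∀ a → ∑[ b ← 𝕍 n ] N a b ≡ Pₙ
  ∑-N a = begin
    ∑[ b ← 𝕍 n ] N a b                              ≡⟨ ∑-cong (𝕍 n) (N-count a) ⟩
    ∑[ b ← 𝕍 n ] ∑[ x ← 𝕍 n ] ⟦ Δᵛ F x a ≟ᵛ b ⟧      ≡⟨ ∑-comm (𝕍 n) (𝕍 n) (λ b x → ⟦ Δᵛ F x a ≟ᵛ b ⟧) ⟩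
    ∑[ x ← 𝕍 n ] ∑[ b ← 𝕍 n ] ⟦ Δᵛ F x a ≟ᵛ b ⟧      ≡⟨ ∑-cong (𝕍 n) (λ x → ∑-𝕍-⟦≟⟧ n (Δᵛ F x a)) ⟩
    ∑[ x ← 𝕍 n ] 1ℤ                                 ≡⟨ ∑-𝕍-const n 1ℤ ⟩
    Pₙ * 1ℤ                                         ≡⟨ ℤ.*-identityʳ Pₙ ⟩
    Pₙ                                              ∎
    where open ≡-Reasoning

  N-𝟎 : ∀ b → N 𝟎 b ≡ Pₙ * ⟦ 𝟎 ≟ᵛ b ⟧
  N-𝟎 b = begin
    N 𝟎 b                                           ≡⟨ N-count 𝟎 b ⟩
    ∑[ x ← 𝕍 n ] ⟦ Δᵛ F x 𝟎 ≟ᵛ b ⟧                   ≡⟨ ∑-cong (𝕍 n) (λ x → cong (λ z → ⟦ z ≟ᵛ b ⟧) (Δᵛ-𝟎 F x)) ⟩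
    ∑[ x ← 𝕍 n ] ⟦ 𝟎 ≟ᵛ b ⟧                          ≡⟨ ∑-𝕍-const n ⟦ 𝟎 ≟ᵛ b ⟧ ⟩
    Pₙ * ⟦ 𝟎 ≟ᵛ b ⟧                                  ∎
    where open ≡-Reasoning

  ∑-N² : ∑[ a ← 𝕍 n ] ∑[ b ← 𝕍 n ] (N a b * N a b) ≡ Q
  ∑-N² = begin
    ∑[ a ← 𝕍 n ] ∑[ b ← 𝕍 n ] (N a b * N a b)
      ≡⟨ ∑-cong (𝕍 n) (λ a → ∑-cong (𝕍 n) (λ b →
          trans (cong₂ _*_ (N-count a b) (N-count a b)) (∑-*-∑ (𝕍 n) (𝕍 n) (X a b) (X a b)))) ⟩
    ∑[ a ← 𝕍 n ] ∑[ b ← 𝕍 n ] ∑[ y ← 𝕍 n ] ∑[ y′ ← 𝕍 n ] (X a b y * X a b y′)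
      ≡⟨ ∑-cong (𝕍 n) (λ a → ∑-∑₂-comm (𝕍 n) (λ b y y′ → X a b y * X a b y′)) ⟩
    ∑[ a ← 𝕍 n ] ∑[ y ← 𝕍 n ] ∑[ y′ ← 𝕍 n ] ∑[ b ← 𝕍 n ] (X a b y * X a b y′)
      ≡⟨ ∑-cong (𝕍 n) (λ a → ∑₂-cong (λ y y′ → ∑-𝕍-⟦≟⟧*⟦≟⟧ n (Δᵛ F y a) (Δᵛ F y′ a))) ⟩
    ∑[ a ← 𝕍 n ] ∑[ y ← 𝕍 n ] ∑[ y′ ← 𝕍 n ] ⟦ Δᵛ F y a ≟ᵛ Δᵛ F y′ a ⟧
      ≡⟨ ∑-comm (𝕍 n) (𝕍 n) (λ a y → ∑[ y′ ← 𝕍 n ] ⟦ Δᵛ F y a ≟ᵛ Δᵛ F y′ a ⟧) ⟩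
    ∑[ y ← 𝕍 n ] ∑[ a ← 𝕍 n ] ∑[ y′ ← 𝕍 n ] ⟦ Δᵛ F y a ≟ᵛ Δᵛ F y′ a ⟧
      ≡⟨ ∑₂-cong (λ y a → ∑-cong (𝕍 n) (λ y′ →
          ⟦⟧-cong (Δᵛ F y a ≟ᵛ Δᵛ F y′ a) (Δᵛ F y a ⊟ Δᵛ F y′ a ≟ᵛ 𝟎) (⇔-sym ⊟≡𝟎⇔≡))) ⟩
    Q ∎
    where
    open ≡-Reasoning
    X : V p n → V p n → V p n → ℤ
    X a b x = ⟦ Δᵛ F x a ≟ᵛ b ⟧

  differentialSpectrum : List ℕ
  differentialSpectrum = concatMap (λ a → map (diffCount p F a) (𝕍 n)) (nonzeroVecs p n)

  ∑-differentialSpectrum : ∀ (φ : ℕ → ℤ) → ∑ differentialSpectrum φ ≡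
    ∑[ a ← 𝕍 n ] ∑[ b ← 𝕍 n ] φ (diffCount p F a b) - ∑[ b ← 𝕍 n ] φ (diffCount p F 𝟎 b)
  ∑-differentialSpectrum φ = begin
    ∑ differentialSpectrum φ
      ≡⟨ ∑-concatMap row (nonzeroVecs p n) φ ⟩
    ∑[ a ← nonzeroVecs p n ] ∑ (row a) φ
      ≡⟨ ∑-filter (λ a → ¬? (a ≟ᵛ 𝟎)) (𝕍 n) (λ a → ∑ (row a) φ) ⟩
    ∑[ a ← 𝕍 n ] (⟦ ¬? (a ≟ᵛ 𝟎) ⟧ * ∑ (row a) φ)
      ≡⟨ ∑-cong (𝕍 n) (λ a → cong₂ _*_ (⟦⟧-¬ (a ≟ᵛ 𝟎)) (∑-map (diffCount p F a) (𝕍 n) φ)) ⟩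
    ∑[ a ← 𝕍 n ] ((1ℤ - ⟦ a ≟ᵛ 𝟎 ⟧) * ∑[ b ← 𝕍 n ] φ (diffCount p F a b))
      ≡⟨ ∑-𝕍-without-𝟎 n (λ a → ∑[ b ← 𝕍 n ] φ (diffCount p F a b)) ⟩
    ∑[ a ← 𝕍 n ] ∑[ b ← 𝕍 n ] φ (diffCount p F a b) - ∑[ b ← 𝕍 n ] φ (diffCount p F 𝟎 b) ∎
    where
    open ≡-Reasoning
    row : V p n → List ℕ
    row a = map (diffCount p F a) (𝕍 n)

  ∑-differentialSpectrum-pos : ∑[ x ← differentialSpectrum ] (+ x) ≡ Pₙ * Pₙ - Pₙ
  ∑-differentialSpectrum-pos = begin
    ∑[ x ← differentialSpectrum ] (+ x)
      ≡⟨ ∑-differentialSpectrum (λ x → + x) ⟩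
    ∑[ a ← 𝕍 n ] ∑[ b ← 𝕍 n ] N a b - ∑[ b ← 𝕍 n ] N 𝟎 b
      ≡⟨ cong₂ _-_ (trans (∑-cong (𝕍 n) ∑-N) (∑-𝕍-const n Pₙ)) (∑-N 𝟎) ⟩
    Pₙ * Pₙ - Pₙ ∎
    where open ≡-Reasoning

  ∑-differentialSpectrum-square : ∑[ x ← differentialSpectrum ] (+ x * + x) ≡ (Pₙ - 1ℤ) * P
  ∑-differentialSpectrum-square = begin
    ∑[ x ← differentialSpectrum ] (+ x * + x)
      ≡⟨ ∑-differentialSpectrum (λ x → + x * + x) ⟩
    ∑[ a ← 𝕍 n ] ∑[ b ← 𝕍 n ] (N a b * N a b) - ∑[ b ← 𝕍 n ] (N 𝟎 b * N 𝟎 b)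
      ≡⟨ cong₂ _-_ (trans ∑-N² Q-value) ∑-N𝟎² ⟩
    Pₙ * Pₙ + (Pₙ - 1ℤ) * P - Pₙ * Pₙ
      ≡⟨ cancel (Pₙ * Pₙ) ((Pₙ - 1ℤ) * P) ⟩
    (Pₙ - 1ℤ) * P ∎
    where
    open ≡-Reasoning
    cancel : ∀ a b → a + b - a ≡ b
    cancel = solve-∀
    square : ∀ b → N 𝟎 b * N 𝟎 b ≡ Pₙ * Pₙ * ⟦ 𝟎 ≟ᵛ b ⟧
    square b = begin
      N 𝟎 b * N 𝟎 b                                    ≡⟨ cong₂ _*_ (N-𝟎 b) (N-𝟎 b) ⟩
      Pₙ * ⟦ 𝟎 ≟ᵛ b ⟧ * (Pₙ * ⟦ 𝟎 ≟ᵛ b ⟧)              ≡⟨ interchange Pₙ ⟦ 𝟎 ≟ᵛ b ⟧ ⟩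
      Pₙ * Pₙ * (⟦ 𝟎 ≟ᵛ b ⟧ * ⟦ 𝟎 ≟ᵛ b ⟧)              ≡⟨ cong (Pₙ * Pₙ *_) (⟦⟧-idem (𝟎 ≟ᵛ b)) ⟩
      Pₙ * Pₙ * ⟦ 𝟎 ≟ᵛ b ⟧                              ∎
      where
      interchange : ∀ a x → a * x * (a * x) ≡ a * a * (x * x)
      interchange = solve-∀
    ∑-N𝟎² : ∑[ b ← 𝕍 n ] (N 𝟎 b * N 𝟎 b) ≡ Pₙ * Pₙ
    ∑-N𝟎² = begin
      ∑[ b ← 𝕍 n ] (N 𝟎 b * N 𝟎 b)                      ≡⟨ ∑-cong (𝕍 n) square ⟩
      ∑[ b ← 𝕍 n ] (Pₙ * Pₙ * ⟦ 𝟎 ≟ᵛ b ⟧)               ≡⟨ *-distribˡ-∑ (𝕍 n) (Pₙ * Pₙ) (λ b → ⟦ 𝟎 ≟ᵛ b ⟧) ⟨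
      Pₙ * Pₙ * ∑[ b ← 𝕍 n ] ⟦ 𝟎 ≟ᵛ b ⟧                 ≡⟨ cong (Pₙ * Pₙ *_) (∑-𝕍-⟦≟⟧ n 𝟎) ⟩
      Pₙ * Pₙ * 1ℤ                                      ≡⟨ ℤ.*-identityʳ (Pₙ * Pₙ) ⟩
      Pₙ * Pₙ                                           ∎

  sumSq-differentialSpectrum : sumSq differentialSpectrum ≡ p ^ t ℕ.* sum differentialSpectrum
  sumSq-differentialSpectrum = ℤ.+-injective (begin
    + sumSq differentialSpectrum
      ≡⟨ ∑-pos-square differentialSpectrum ⟨
    ∑[ x ← differentialSpectrum ] (+ x * + x)
      ≡⟨ ∑-differentialSpectrum-square ⟩
    (Pₙ - 1ℤ) * P
      ≡⟨ cong ((Pₙ - 1ℤ) *_) P≡Pₙ*T ⟩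
    (Pₙ - 1ℤ) * (Pₙ * T)
      ≡⟨ rearrange Pₙ T ⟩
    T * (Pₙ * Pₙ - Pₙ)
      ≡⟨ cong (T *_) (trans (sym ∑-differentialSpectrum-pos) (∑-pos differentialSpectrum)) ⟩
    T * + sum differentialSpectrum
      ≡⟨ ℤ.pos-* (p ^ t) (sum differentialSpectrum) ⟨
    + (p ^ t ℕ.* sum differentialSpectrum) ∎)
    where
    open ≡-Reasoning
    T : ℤ
    T = + p ^ t
    P≡Pₙ*T : P ≡ Pₙ * T
    P≡Pₙ*T = trans (cong +_ (ℕ.^-distribˡ-+-* p n t)) (ℤ.pos-* (p ^ n) (p ^ t))
    rearrange : ∀ Pₙ T → (Pₙ - 1ℤ) * (Pₙ * T) ≡ T * (Pₙ * Pₙ - Pₙ)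
    rearrange = solve-∀

  sum-differentialSpectrum≢0 : 1 ≤ n → sum differentialSpectrum ≢ 0
  sum-differentialSpectrum≢0 1≤n sum≡0 = ℕ.<-irrefl (sym (ℤ.+-injective Pₙ≡1)) (2≤p^n 1≤n)
    where
    open ≡-Reasoning
    2≤p^n : ∀ {m} → 1 ≤ m → 2 ≤ p ^ m
    2≤p^n {ℕ.suc m} _ = ℕ.*-mono-≤ (ℕ.nonTrivial⇒n>1 p {{prime⇒nonTrivial p-prime}}) (ℕ.m^n>0 p m)
    Pₙ≡1 : Pₙ ≡ 1ℤ
    Pₙ≡1 = ℤ.*-cancelˡ-≡ Pₙ Pₙ 1ℤ {{ℕ.m^n≢0 p n}} (begin
      Pₙ * Pₙ
        ≡⟨ split Pₙ ⟩
      (Pₙ * Pₙ - Pₙ) + Pₙ * 1ℤ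
        ≡⟨ cong (_+ Pₙ * 1ℤ) (trans (sym ∑-differentialSpectrum-pos) (∑-pos differentialSpectrum)) ⟩
      + sum differentialSpectrum + Pₙ * 1ℤ
        ≡⟨ cong (λ s → + s + Pₙ * 1ℤ) sum≡0 ⟩
      0ℤ + Pₙ * 1ℤ
        ≡⟨ ℤ.+-identityˡ (Pₙ * 1ℤ) ⟩
      Pₙ * 1ℤ ∎)
      where
      split : ∀ a → a * a ≡ (a * a - a) + a * 1ℤ
      split = solve-∀

theorem5p6 : (p : ℕ) .{{_ : NonZero p}} → Prime p → (n t : ℕ) → 1 ≤ n → 0 < t →
    (F : V p n → V p n) → IsPlateaued p n t F →
    (p ^ t ≤ diffUniformity p F)
    × ((diffUniformity p F ≡ p ^ t) ⇔
    (∀ (a b : V p n) → ¬ (a ≡ 0ᵥ p) →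
    (diffCount p F a b ≡ 0) ⊎ (diffCount p F a b ≡ p ^ t)))
theorem5p6 p p-prime n t 1≤n _ F F-plateaued =
    maximum-≥ (p ^ t) differentialSpectrum sumSq-differentialSpectrum (sum-differentialSpectrum≢0 1≤n)
  , VectorSums.All-nonzero-rows⇔ p (diffCount p F)
      ⇔-∘ maximum≡⇔ (p ^ t) differentialSpectrum sumSq-differentialSpectrum (sum-differentialSpectrum≢0 1≤n)
  where open Coincidences p p-prime t F F-plateaued
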